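{- Let $P$ be a graded poset of rank $d+1\ge1$ and let $y=x-1$. For $q\in P$ write $Q=[\hat0,q]$. Then \[ \hat h(P,x)-x^d\hat h(P,1/x)=-\big[\mu_P(\hat0,\hat1)-(-1)^{d+1}\big]y^d+\sum_{q\in P,\ 1\le\rho(q)\le d}\Big(-y^{d-\rho(q)}\big(\hat g(Q,x)+y\,\hat h(Q,x)\big)\mu_P(q,\hat1)-(-y)^{d-\rho(q)}\hat g(Q,1/x)\,x^{\rho(q)}\Big). \]
   Context: Posets are finite and graded with unique $\hat0$, $\hat1$, rank function $\rho$ ($\rho(\hat0)=0$), rank $\rho(\hat1)$, and Möbius function $\mu_P$. Toric polynomials: for the one-element poset, $\hat h=\hat g=1$. For $P$ of rank $d+1\ge1$, $\hat h(P,x)=\sum_{t\in P,\ t\ne\hat1}\hat g([\hat0,t],x)(x-1)^{d-\rho(t)}$ (each interval $[\hat0,t]$ is a graded poset of rank $\rho(t)$); writing $\hat h(P,x)=\sum_{i=0}^d\hat h_i(P)x^{d-i}$, one sets $\hat g(P,x)=\hat h_d+\sum_{m=1}^{\lfloor d/2\rfloor}(\hat h_{d-m}-\hat h_{d-m+1})x^m$. -}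

module Defs where

open import Data.Nat as ℕ using (ℕ; zero; suc; _∸_; _/_)
open import Data.Integer as ℤ using (ℤ; +_; -[1+_]; 0ℤ; 1ℤ; -_)
open import Data.Fin using (Fin)
open import Data.Fin.Properties using () renaming (_≟_ to _≟F_)
open import Data.List using (List; []; _∷_; foldr; map; filter; upTo; replicate; _++_)
open import Data.List.Base using (allFin)
open import Data.Product using (_×_; _,_)
open import Data.Sum using (_⊎_)
open import Relation.Nullary using (¬_; Dec; yes; no; _×-dec_; ¬?)
open import Relation.Binary.PropositionalEquality using (_≡_)
open import Relation.Binary.Definitions using (Decidable)

-- Polynomials over ℤ: coefficient lists, lowest degree first.

Poly : Set
Poly = List ℤ

_+p_ : Poly → Poly → Poly
[]       +p q        = q
p        +p []       = p
(a ∷ p)  +p (b ∷ q)  = (a ℤ.+ b) ∷ (p +p q)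

scale : ℤ → Poly → Poly
scale c = map (c ℤ.*_)

_*p_ : Poly → Poly → Poly
[]      *p q = []
(a ∷ p) *p q = scale a q +p (0ℤ ∷ (p *p q))

coeff : Poly → ℕ → ℤ
coeff []      _       = 0ℤ
coeff (a ∷ p) zero    = a
coeff (a ∷ p) (suc i) = coeff p i

-- Laurent polynomials over ℤ: (s , p) represents x^(-s) · p(x).

Laur : Set
Laur = ℕ × Poly

infixl 6 _+L_ _-L_
infixl 7 _*L_
infixr 8 _^L_
infix 9 -L_

poly : Poly → Laur
poly p = 0 , p

shiftUp : ℕ → Poly → Poly
shiftUp k p = replicate k 0ℤ ++ p

_+L_ : Laur → Laur → Laur
(s , p) +L (t , q) = (s ℕ.+ t) , (shiftUp t p +p shiftUp s q)

_*L_ : Laur → Laur → Laur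
(s , p) *L (t , q) = (s ℕ.+ t) , (p *p q)

-L_ : Laur → Laur
-L (s , p) = s , scale (- 1ℤ) p

_-L_ : Laur → Laur → Laur
a -L b = a +L (-L b)

constL : ℤ → Laur
constL c = poly (c ∷ [])

0L 1L : Laur
0L = poly []
1L = constL 1ℤ

xL : Laur
xL = poly (0ℤ ∷ 1ℤ ∷ [])

xinvL : Laur
xinvL = 1 , (1ℤ ∷ [])

_^L_ : Laur → ℕ → Laur
a ^L zero  = 1L
a ^L suc n = a *L (a ^L n)

coeffL : Laur → ℤ → ℤ
coeffL (s , p) k with k ℤ.+ + s
... | + m    = coeff p m
... | -[1+ _ ] = 0ℤ

infix 4 _≈L_
_≈L_ : Laur → Laur → Set
a ≈L b = ∀ (k : ℤ) → coeffL a k ≡ coeffL b k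

evalAt : Poly → Laur → Laur
evalAt p z = foldr (λ a acc → constL a +L (z *L acc)) 0L p

ΣL : {A : Set} → List A → (A → Laur) → Laur
ΣL xs f = foldr (λ a acc → f a +L acc) 0L xs

Σℤ : {A : Set} → List A → (A → ℤ) → ℤ
Σℤ xs f = foldr (λ a acc → f a ℤ.+ acc) 0ℤ xs

record GradedPoset : Set₁ where
  field
    size      : ℕ
    _≤_       : Fin size → Fin size → Set
    _≤?_      : Decidable _≤_
    ≤-refl    : ∀ x → x ≤ x
    ≤-antisym : ∀ {x y} → x ≤ y → y ≤ x → x ≡ y
    ≤-trans   : ∀ {x y z} → x ≤ y → y ≤ z → x ≤ z
    𝟘 𝟙       : Fin size
    𝟘-min     : ∀ x → 𝟘 ≤ x
    𝟙-max     : ∀ x → x ≤ 𝟙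
    ρ         : Fin size → ℕ
    ρ-𝟘       : ρ 𝟘 ≡ 0
    ρ-cover   : ∀ x y → x ≤ y → ¬ (x ≡ y) →
                (∀ z → x ≤ z → z ≤ y → (z ≡ x) ⊎ (z ≡ y)) →
                ρ y ≡ suc (ρ x)

module _ (P : GradedPoset) where
  open GradedPoset P

  _<_ : Fin size → Fin size → Set
  x < y = x ≤ y × ¬ (x ≡ y)

  _<?_ : Decidable _<_
  x <? y = (x ≤? y) ×-dec ¬? (x ≟F y)

  elems : List (Fin size)
  elems = allFin size

  -- Möbius function: μ(a,a)=1, μ(a,b) = -Σ_{a≤z<b} μ(a,z) for a<b, 0 otherwise.
  -- (fuel-based recursion; fuel ρ b suffices)
  μfuel : ℕ → Fin size → Fin size → ℤ
  μfuel k a b with a ≟F b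
  ... | yes _ = 1ℤ
  ... | no _ with a ≤? b | k
  ...   | no _  | _     = 0ℤ
  ...   | yes _ | zero  = 0ℤ
  ...   | yes _ | suc k' =
            - Σℤ (filter (λ z → (a ≤? z) ×-dec (z <? b)) elems) (λ z → μfuel k' a z)

  μ : Fin size → Fin size → ℤ
  μ a b = μfuel (ρ b) a b

  y : Laur
  y = xL -L 1L

  -- ĝ from ĥ for an interval of rank d+1:
  -- ĥ = Σ_{i=0}^d ĥ_i x^(d-i),  ĝ = ĥ_d + Σ_{m=1}^{⌊d/2⌋} (ĥ_{d-m} - ĥ_{d-m+1}) x^m
  gFromH : ℕ → Poly → Poly
  gFromH d h = map gm (upTo (suc (d / 2)))
    where
      hi : ℕ → ℤ
      hi i = coeff h (d ∸ i)
      gm : ℕ → ℤ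
      gm zero    = hi d
      gm (suc m) = hi (d ∸ suc m) ℤ.- hi (d ∸ m)

  -- toric polynomials of the lower intervals [0̂,t], computed in P.
  -- (fuel-based; fuel ρ t suffices)
  -- hSum k t d = Σ_{s<t} ĝ([0̂,s]) (x-1)^(d-ρ s)  computed with fuel k for ĝ
  mutual
    gFuel : ℕ → Fin size → Poly
    gFuel zero    t = 1ℤ ∷ []
    gFuel (suc k) t with ρ t
    ... | zero  = 1ℤ ∷ []
    ... | suc d = gFromH d (hSum k t d)

    hSum : ℕ → Fin size → ℕ → Poly
    hSum k t d = foldr _+p_ []
      (map (λ s → gFuel k s *p powP (-[1+ 0 ] ∷ 1ℤ ∷ []) (d ∸ ρ s))
           (filter (λ s → s <? t) elems))

    powP : Poly → ℕ → Poly
    powP p zero    = 1ℤ ∷ []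
    powP p (suc n) = p *p powP p n

  gHat : Fin size → Poly
  gHat t = gFuel (ρ t) t

  hHat : Fin size → Poly
  hHat t with ρ t
  ... | zero  = 1ℤ ∷ []
  ... | suc d = hSum d t d

-- Write y = x − 1 and T_s = ĝ([0̂,s]) y^(d−ρ(s)), so that ĥ(P) = Σ_{s<1̂} T_s and
-- x^d ĥ(P,1/x) = Σ_{s<1̂} (−y)^(d−ρ(s)) ĝ([0̂,s],1/x) x^ρ(s).  For 1 ≤ ρ(q) ≤ d the
-- recursion defining ĥ(Q) gives y^(d−ρ(q)) (ĝ(Q) + y ĥ(Q)) = Σ_{s≤q} T_s.  The Möbius
-- function also satisfies the dual recursion, so Σ_{s≤q<1̂} μ(q,1̂) = −1 for s < 1̂ and hence
-- Σ_{q<1̂} μ(q,1̂) Σ_{s≤q} T_s = −ĥ(P).  Separating the terms of 0̂, where T_0̂ = y^d,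
-- the claim becomes a ring identity in ℤ[x,x⁻¹].
module Submission where

open import Defs

open import Level using (0ℓ)
open import Algebra.Bundles using (AbelianGroup; CommutativeMonoid; CommutativeRing)
open import Data.Bool using (if_then_else_)
open import Data.Fin using (Fin; zero; suc)
open import Data.Fin.Properties using () renaming (_≟_ to _≟F_)
open import Data.Integer as ℤ using (ℤ; +_; -[1+_]; 0ℤ; 1ℤ)
import Data.Integer.Properties as ℤP
import Data.Integer.Tactic.RingSolver as ℤ-Solver
open import Data.List using (List; []; _∷_; map; foldr; filter; allFin; length)
open import Data.List.Properties using (map-tabulate; filter-some; map-cong-local)
open import Data.List.Membership.Propositional using (_∈_; lose)
open import Data.List.Membership.Propositional.Properties using (∈-allFin)
open import Data.List.Relation.Unary.All using (All; []; _∷_)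
import Data.List.Relation.Unary.All as All
open import Data.List.Relation.Unary.All.Properties using (all-filter)
open import Data.List.Relation.Unary.Any using (here; there; any?; satisfied)
open import Data.Maybe using (Maybe; just; nothing)
open import Data.Nat as ℕ using (ℕ; zero; suc; _∸_; z≤n; s≤s)
import Data.Nat.Properties as ℕP
import Data.Nat.Tactic.RingSolver as ℕ-Solver
open import Data.Product using (_×_; _,_; proj₁)
open import Data.Sum using (_⊎_; inj₁; inj₂; [_,_]′)
import Data.Sum as Sum
open import Function using (_∘_; id)
open import Relation.Nullary using (¬_; Dec; yes; no; does; _×-dec_; contradiction)
open import Relation.Unary as U using (Pred)
import Relation.Binary.PropositionalEquality as ≡
open ≡ using (_≡_; refl; sym; trans; cong; cong₂; subst; module ≡-Reasoning)
open import Tactic.RingSolver.Core.AlmostCommutativeRing using (AlmostCommutativeRing; fromCommutativeRing)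
import Tactic.RingSolver as Solver

open import Algebra.Properties.Group (AbelianGroup.group ℤP.+-0-abelianGroup)
  using (identityˡ-unique; inverseʳ-unique)

-- Polynomials up to coefficientwise equality

-- A record, so that the indices are inferable.
infix 4 _≈ₚ_
record _≈ₚ_ (p q : Poly) : Set where
  constructor mk≈ₚ
  field coeff-≈ₚ : ∀ i → coeff p i ≡ coeff q i
open _≈ₚ_

≈ₚ-refl : ∀ {p} → p ≈ₚ p
≈ₚ-refl = mk≈ₚ λ _ → refl

≈ₚ-sym : ∀ {p q} → p ≈ₚ q → q ≈ₚ p
≈ₚ-sym e = mk≈ₚ λ i → sym (coeff-≈ₚ e i)

≈ₚ-trans : ∀ {p q r} → p ≈ₚ q → q ≈ₚ r → p ≈ₚ r
≈ₚ-trans e f = mk≈ₚ λ i → trans (coeff-≈ₚ e i) (coeff-≈ₚ f i)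

≡⇒≈ₚ : ∀ {p q} → p ≡ q → p ≈ₚ q
≡⇒≈ₚ refl = ≈ₚ-refl

∷-cong : ∀ {a b p q} → a ≡ b → p ≈ₚ q → a ∷ p ≈ₚ b ∷ q
∷-cong a≡b p≈q = mk≈ₚ λ { zero → a≡b ; (suc i) → coeff-≈ₚ p≈q i }

∷-injectiveʳ : ∀ {a b p q} → a ∷ p ≈ₚ b ∷ q → p ≈ₚ q
∷-injectiveʳ e = mk≈ₚ λ i → coeff-≈ₚ e (suc i)

∷-≈ₚ[] : ∀ {a p} → a ≡ 0ℤ → p ≈ₚ [] → a ∷ p ≈ₚ []
∷-≈ₚ[] a≡0 p≈0 = mk≈ₚ λ { zero → a≡0 ; (suc i) → coeff-≈ₚ p≈0 i }

coeff-+p : ∀ p q i → coeff (p +p q) i ≡ coeff p i ℤ.+ coeff q i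
coeff-+p []      q       i       = sym (ℤP.+-identityˡ _)
coeff-+p (a ∷ p) []      i       = sym (ℤP.+-identityʳ _)
coeff-+p (a ∷ p) (b ∷ q) zero    = refl
coeff-+p (a ∷ p) (b ∷ q) (suc i) = coeff-+p p q i

coeff-scale : ∀ c p i → coeff (scale c p) i ≡ c ℤ.* coeff p i
coeff-scale c []      i       = sym (ℤP.*-zeroʳ c)
coeff-scale c (a ∷ p) zero    = refl
coeff-scale c (a ∷ p) (suc i) = coeff-scale c p i

+p-cong : ∀ {p p′ q q′} → p ≈ₚ p′ → q ≈ₚ q′ → p +p q ≈ₚ p′ +p q′
+p-cong {p} {p′} {q} {q′} e f = mk≈ₚ λ i → begin
  coeff (p +p q) i              ≡⟨ coeff-+p p q i ⟩
  coeff p i ℤ.+ coeff q i       ≡⟨ cong₂ ℤ._+_ (coeff-≈ₚ e i) (coeff-≈ₚ f i) ⟩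
  coeff p′ i ℤ.+ coeff q′ i     ≡⟨ coeff-+p p′ q′ i ⟨
  coeff (p′ +p q′) i            ∎
  where open ≡-Reasoning

+p-comm : ∀ p q → p +p q ≈ₚ q +p p
+p-comm p q = mk≈ₚ λ i →
  trans (coeff-+p p q i) (trans (ℤP.+-comm (coeff p i) _) (sym (coeff-+p q p i)))

+p-assoc : ∀ p q r → (p +p q) +p r ≈ₚ p +p (q +p r)
+p-assoc p q r = mk≈ₚ λ i → begin
  coeff ((p +p q) +p r) i                       ≡⟨ coeff-+p (p +p q) r i ⟩
  coeff (p +p q) i ℤ.+ coeff r i                ≡⟨ cong (ℤ._+ coeff r i) (coeff-+p p q i) ⟩
  (coeff p i ℤ.+ coeff q i) ℤ.+ coeff r i       ≡⟨ ℤP.+-assoc (coeff p i) _ _ ⟩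
  coeff p i ℤ.+ (coeff q i ℤ.+ coeff r i)       ≡⟨ cong (λ z → coeff p i ℤ.+ z) (coeff-+p q r i) ⟨
  coeff p i ℤ.+ coeff (q +p r) i                ≡⟨ coeff-+p p (q +p r) i ⟨
  coeff (p +p (q +p r)) i                       ∎
  where open ≡-Reasoning

+p-identityʳ : ∀ p → p +p [] ≈ₚ p
+p-identityʳ p = mk≈ₚ λ i → trans (coeff-+p p [] i) (ℤP.+-identityʳ _)

+p-commutativeMonoid : CommutativeMonoid 0ℓ 0ℓ
+p-commutativeMonoid = record
  { Carrier = Poly ; _≈_ = _≈ₚ_ ; _∙_ = _+p_ ; ε = []
  ; isCommutativeMonoid = record
    { isMonoid = record
      { isSemigroup = record
        { isMagma = record
          { isEquivalence = record { refl = ≈ₚ-refl ; sym = ≈ₚ-sym ; trans = ≈ₚ-trans }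
          ; ∙-cong = +p-cong }
        ; assoc = +p-assoc }
      ; identity = (λ _ → ≈ₚ-refl) , +p-identityʳ }
    ; comm = +p-comm } }

open import Algebra.Properties.CommutativeSemigroup
  (CommutativeMonoid.commutativeSemigroup +p-commutativeMonoid)
  using () renaming (interchange to +p-interchange; x∙yz≈y∙xz to +p-x∙yz≈y∙xz)

scale-cong : ∀ c {p q} → p ≈ₚ q → scale c p ≈ₚ scale c q
scale-cong c {p} {q} e = mk≈ₚ λ i →
  trans (coeff-scale c p i) (trans (cong (c ℤ.*_) (coeff-≈ₚ e i)) (sym (coeff-scale c q i)))

scale-zero : ∀ {a} p → a ≡ 0ℤ → scale a p ≈ₚ []
scale-zero p refl = mk≈ₚ λ i → coeff-scale 0ℤ p i

scale-+p : ∀ c p q → scale c (p +p q) ≈ₚ scale c p +p scale c q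
scale-+p c p q = mk≈ₚ λ i → begin
  coeff (scale c (p +p q)) i                      ≡⟨ coeff-scale c (p +p q) i ⟩
  c ℤ.* coeff (p +p q) i                          ≡⟨ cong (c ℤ.*_) (coeff-+p p q i) ⟩
  c ℤ.* (coeff p i ℤ.+ coeff q i)                 ≡⟨ ℤP.*-distribˡ-+ c _ _ ⟩
  c ℤ.* coeff p i ℤ.+ c ℤ.* coeff q i             ≡⟨ cong₂ ℤ._+_ (coeff-scale c p i) (coeff-scale c q i) ⟨
  coeff (scale c p) i ℤ.+ coeff (scale c q) i     ≡⟨ coeff-+p (scale c p) _ i ⟨
  coeff (scale c p +p scale c q) i                ∎
  where open ≡-Reasoning

scale-distribʳ : ∀ a b p → scale (a ℤ.+ b) p ≈ₚ scale a p +p scale b p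
scale-distribʳ a b p = mk≈ₚ λ i → begin
  coeff (scale (a ℤ.+ b) p) i                     ≡⟨ coeff-scale (a ℤ.+ b) p i ⟩
  (a ℤ.+ b) ℤ.* coeff p i                         ≡⟨ ℤP.*-distribʳ-+ (coeff p i) a b ⟩
  a ℤ.* coeff p i ℤ.+ b ℤ.* coeff p i             ≡⟨ cong₂ ℤ._+_ (coeff-scale a p i) (coeff-scale b p i) ⟨
  coeff (scale a p) i ℤ.+ coeff (scale b p) i     ≡⟨ coeff-+p (scale a p) _ i ⟨
  coeff (scale a p +p scale b p) i                ∎
  where open ≡-Reasoning

scale-scale : ∀ a b p → scale a (scale b p) ≈ₚ scale (a ℤ.* b) p
scale-scale a b p = mk≈ₚ λ i → begin
  coeff (scale a (scale b p)) i       ≡⟨ coeff-scale a (scale b p) i ⟩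
  a ℤ.* coeff (scale b p) i           ≡⟨ cong (a ℤ.*_) (coeff-scale b p i) ⟩
  a ℤ.* (b ℤ.* coeff p i)             ≡⟨ ℤP.*-assoc a b _ ⟨
  a ℤ.* b ℤ.* coeff p i               ≡⟨ coeff-scale (a ℤ.* b) p i ⟨
  coeff (scale (a ℤ.* b) p) i         ∎
  where open ≡-Reasoning

scale-one : ∀ p → scale 1ℤ p ≈ₚ p
scale-one p = mk≈ₚ λ i → trans (coeff-scale 1ℤ p i) (ℤP.*-identityˡ _)

*p-zeroˡ : ∀ {p} → p ≈ₚ [] → ∀ q → p *p q ≈ₚ []
*p-zeroˡ {[]}    _   q = ≈ₚ-refl
*p-zeroˡ {a ∷ p} p≈0 q =
  +p-cong (scale-zero q (coeff-≈ₚ p≈0 0)) (∷-≈ₚ[] refl (*p-zeroˡ {p} (mk≈ₚ λ i → coeff-≈ₚ p≈0 (suc i)) q))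

*p-zeroʳ : ∀ p → p *p [] ≈ₚ []
*p-zeroʳ []      = ≈ₚ-refl
*p-zeroʳ (a ∷ p) = ∷-≈ₚ[] refl (*p-zeroʳ p)

*p-congˡ : ∀ {p p′} → p ≈ₚ p′ → ∀ q → p *p q ≈ₚ p′ *p q
*p-congˡ {[]}    {p′}     e q = ≈ₚ-sym (*p-zeroˡ (≈ₚ-sym e) q)
*p-congˡ {a ∷ p} {[]}     e q = *p-zeroˡ e q
*p-congˡ {a ∷ p} {b ∷ p′} e q =
  +p-cong (≡⇒≈ₚ (cong (λ c → scale c q) (coeff-≈ₚ e 0)))
          (∷-cong refl (*p-congˡ (∷-injectiveʳ e) q))

*p-congʳ : ∀ p {q q′} → q ≈ₚ q′ → p *p q ≈ₚ p *p q′
*p-congʳ []      e = ≈ₚ-refl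
*p-congʳ (a ∷ p) e = +p-cong (scale-cong a e) (∷-cong refl (*p-congʳ p e))

*p-∷ʳ : ∀ p b q → p *p (b ∷ q) ≈ₚ scale b p +p (0ℤ ∷ (p *p q))
*p-∷ʳ []      b q = ≈ₚ-sym (∷-≈ₚ[] refl ≈ₚ-refl)
*p-∷ʳ (a ∷ p) b q =
  ∷-cong (cong (ℤ._+ 0ℤ) (ℤP.*-comm a b))
         (≈ₚ-trans (+p-cong (≈ₚ-refl {scale a q}) (*p-∷ʳ p b q))
                   (+p-x∙yz≈y∙xz (scale a q) (scale b p) _))

*p-comm : ∀ p q → p *p q ≈ₚ q *p p
*p-comm []      q = ≈ₚ-sym (*p-zeroʳ q)
*p-comm (a ∷ p) q =
  ≈ₚ-trans (+p-cong (≈ₚ-refl {scale a q}) (∷-cong refl (*p-comm p q))) (≈ₚ-sym (*p-∷ʳ q a p))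

0∷-*p : ∀ p q → (0ℤ ∷ p) *p q ≈ₚ 0ℤ ∷ (p *p q)
0∷-*p p q = +p-cong (scale-zero q refl) ≈ₚ-refl

*p-distribʳ : ∀ r p q → (p +p q) *p r ≈ₚ (p *p r) +p (q *p r)
*p-distribʳ r []      q       = ≈ₚ-refl
*p-distribʳ r (a ∷ p) []      = ≈ₚ-sym (+p-identityʳ _)
*p-distribʳ r (a ∷ p) (b ∷ q) =
  ≈ₚ-trans (+p-cong (scale-distribʳ a b r) (∷-cong refl (*p-distribʳ r p q)))
           (+p-interchange (scale a r) (scale b r) (0ℤ ∷ (p *p r)) (0ℤ ∷ (q *p r)))

*p-distribˡ : ∀ p q r → p *p (q +p r) ≈ₚ (p *p q) +p (p *p r)
*p-distribˡ p q r =
  ≈ₚ-trans (*p-comm p _) (≈ₚ-trans (*p-distribʳ p q r) (+p-cong (*p-comm q p) (*p-comm r p)))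

scale-*p : ∀ c p q → scale c p *p q ≈ₚ scale c (p *p q)
scale-*p c []      q = ≈ₚ-refl
scale-*p c (a ∷ p) q =
  ≈ₚ-trans (+p-cong (≈ₚ-sym (scale-scale c a q)) (∷-cong (sym (ℤP.*-zeroʳ c)) (scale-*p c p q)))
           (≈ₚ-sym (scale-+p c (scale a q) _))

*p-assoc : ∀ p q r → (p *p q) *p r ≈ₚ p *p (q *p r)
*p-assoc []      q r = ≈ₚ-refl
*p-assoc (a ∷ p) q r =
  ≈ₚ-trans (*p-distribʳ r (scale a q) _)
           (+p-cong (scale-*p a q r) (≈ₚ-trans (0∷-*p (p *p q) r) (∷-cong refl (*p-assoc p q r))))

*p-identityˡ : ∀ p → (1ℤ ∷ []) *p p ≈ₚ p
*p-identityˡ p = ≈ₚ-trans (+p-cong (≈ₚ-refl {scale 1ℤ p}) (∷-≈ₚ[] refl ≈ₚ-refl))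
                          (≈ₚ-trans (+p-identityʳ _) (scale-one p))

shiftUp-+ : ∀ a b p → shiftUp (a ℕ.+ b) p ≡ shiftUp a (shiftUp b p)
shiftUp-+ zero    b p = refl
shiftUp-+ (suc a) b p = cong (0ℤ ∷_) (shiftUp-+ a b p)

shiftUp-cong : ∀ k {p q} → p ≈ₚ q → shiftUp k p ≈ₚ shiftUp k q
shiftUp-cong zero    e = e
shiftUp-cong (suc k) e = ∷-cong refl (shiftUp-cong k e)

shiftUp-+p : ∀ k p q → shiftUp k (p +p q) ≈ₚ shiftUp k p +p shiftUp k q
shiftUp-+p zero    p q = ≈ₚ-refl
shiftUp-+p (suc k) p q = ∷-cong refl (shiftUp-+p k p q)

shiftUp-*pˡ : ∀ k p q → shiftUp k p *p q ≈ₚ shiftUp k (p *p q)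
shiftUp-*pˡ zero    p q = ≈ₚ-refl
shiftUp-*pˡ (suc k) p q = ≈ₚ-trans (0∷-*p (shiftUp k p) q) (∷-cong refl (shiftUp-*pˡ k p q))

shiftUp-*pʳ : ∀ k p q → p *p shiftUp k q ≈ₚ shiftUp k (p *p q)
shiftUp-*pʳ k p q =
  ≈ₚ-trans (*p-comm p _) (≈ₚ-trans (shiftUp-*pˡ k q p) (shiftUp-cong k (*p-comm q p)))

yₚ : Poly
yₚ = -[1+ 0 ] ∷ 1ℤ ∷ []

-- Laurent polynomials form a commutative ring

coeffZ : Poly → ℤ → ℤ
coeffZ p (+ m)    = coeff p m
coeffZ p -[1+ _ ] = 0ℤ

coeffL-coeffZ : ∀ s p k → coeffL (s , p) k ≡ coeffZ p (k ℤ.+ + s)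
coeffL-coeffZ s p k with k ℤ.+ + s
... | + m      = refl
... | -[1+ _ ] = refl

coeffZ-cong : ∀ {p q} → p ≈ₚ q → ∀ j → coeffZ p j ≡ coeffZ q j
coeffZ-cong e (+ m)    = coeff-≈ₚ e m
coeffZ-cong e -[1+ _ ] = refl

coeffZ-+p : ∀ p q j → coeffZ (p +p q) j ≡ coeffZ p j ℤ.+ coeffZ q j
coeffZ-+p p q (+ m)    = coeff-+p p q m
coeffZ-+p p q -[1+ _ ] = refl

coeffZ-scale : ∀ c p j → coeffZ (scale c p) j ≡ c ℤ.* coeffZ p j
coeffZ-scale c p (+ m)    = coeff-scale c p m
coeffZ-scale c p -[1+ _ ] = sym (ℤP.*-zeroʳ c)

coeffZ-shiftUp : ∀ t p j → coeffZ (shiftUp t p) j ≡ coeffZ p (j ℤ.- + t)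
coeffZ-shiftUp zero    p j         = cong (coeffZ p) (sym (ℤP.+-identityʳ j))
coeffZ-shiftUp (suc t) p (+ zero)  = refl
coeffZ-shiftUp (suc t) p (+ suc m) =
  trans (coeffZ-shiftUp t p (+ m)) (cong (coeffZ p) (sym (suc-∸-suc (+ m) (+ t))))
  where
  suc-∸-suc : ∀ a b → (+ 1 ℤ.+ a) ℤ.- (+ 1 ℤ.+ b) ≡ a ℤ.- b
  suc-∸-suc = ℤ-Solver.solve-∀
coeffZ-shiftUp (suc t) p -[1+ n ]  = refl

-- The relation _≈L_ as a record, so that its indices are inferable.
infix 4 _≈ₗ_
record _≈ₗ_ (a b : Laur) : Set where
  constructor mk≈ₗ
  field coeffL-≈ₗ : a ≈L b
open _≈ₗ_

≈ₗ-refl : ∀ {a} → a ≈ₗ a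
≈ₗ-refl = mk≈ₗ λ _ → refl

≈ₗ-sym : ∀ {a b} → a ≈ₗ b → b ≈ₗ a
≈ₗ-sym e = mk≈ₗ λ k → sym (coeffL-≈ₗ e k)

≈ₗ-trans : ∀ {a b c} → a ≈ₗ b → b ≈ₗ c → a ≈ₗ c
≈ₗ-trans e f = mk≈ₗ λ k → trans (coeffL-≈ₗ e k) (coeffL-≈ₗ f k)

≡⇒≈ₗ : ∀ {a b} → a ≡ b → a ≈ₗ b
≡⇒≈ₗ refl = ≈ₗ-refl

coeffL-+L : ∀ a b k → coeffL (a +L b) k ≡ coeffL a k ℤ.+ coeffL b k
coeffL-+L (s , p) (t , q) k = begin
  coeffL ((s ℕ.+ t) , (shiftUp t p +p shiftUp s q)) k
    ≡⟨ coeffL-coeffZ (s ℕ.+ t) _ k ⟩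
  coeffZ (shiftUp t p +p shiftUp s q) (k ℤ.+ + (s ℕ.+ t))
    ≡⟨ coeffZ-+p (shiftUp t p) (shiftUp s q) (k ℤ.+ + (s ℕ.+ t)) ⟩
  coeffZ (shiftUp t p) (k ℤ.+ + (s ℕ.+ t)) ℤ.+ coeffZ (shiftUp s q) (k ℤ.+ + (s ℕ.+ t))
    ≡⟨ cong₂ ℤ._+_ (coeffZ-shiftUp t p (k ℤ.+ + (s ℕ.+ t))) (coeffZ-shiftUp s q (k ℤ.+ + (s ℕ.+ t))) ⟩
  coeffZ p (k ℤ.+ + (s ℕ.+ t) ℤ.- + t) ℤ.+ coeffZ q (k ℤ.+ + (s ℕ.+ t) ℤ.- + s)
    ≡⟨ cong₂ ℤ._+_
         (cong (coeffZ p) (trans (cong (λ z → k ℤ.+ z ℤ.- + t) (ℤP.pos-+ s t)) (cancelʳ k (+ s) (+ t))))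
         (cong (coeffZ q) (trans (cong (λ z → k ℤ.+ z ℤ.- + s) (ℤP.pos-+ s t)) (cancelˡ k (+ s) (+ t)))) ⟩
  coeffZ p (k ℤ.+ + s) ℤ.+ coeffZ q (k ℤ.+ + t)
    ≡⟨ cong₂ ℤ._+_ (coeffL-coeffZ s p k) (coeffL-coeffZ t q k) ⟨
  coeffL (s , p) k ℤ.+ coeffL (t , q) k
    ∎
  where
  open ≡-Reasoning
  cancelʳ : ∀ k s t → k ℤ.+ (s ℤ.+ t) ℤ.- t ≡ k ℤ.+ s
  cancelʳ = ℤ-Solver.solve-∀
  cancelˡ : ∀ k s t → k ℤ.+ (s ℤ.+ t) ℤ.- s ≡ k ℤ.+ t
  cancelˡ = ℤ-Solver.solve-∀

coeffL-neg : ∀ a k → coeffL (-L a) k ≡ ℤ.- coeffL a k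
coeffL-neg (s , p) k = begin
  coeffL (-L (s , p)) k                   ≡⟨ coeffL-coeffZ s _ k ⟩
  coeffZ (scale (ℤ.- 1ℤ) p) (k ℤ.+ + s)   ≡⟨ coeffZ-scale (ℤ.- 1ℤ) p (k ℤ.+ + s) ⟩
  ℤ.- 1ℤ ℤ.* coeffZ p (k ℤ.+ + s)         ≡⟨ ℤP.-1*i≡-i _ ⟩
  ℤ.- coeffZ p (k ℤ.+ + s)                ≡⟨ cong ℤ.-_ (coeffL-coeffZ s p k) ⟨
  ℤ.- coeffL (s , p) k                    ∎
  where open ≡-Reasoning

coeffL-0L : ∀ k → coeffL 0L k ≡ 0ℤ
coeffL-0L k = trans (coeffL-coeffZ 0 [] k) (coeffZ-[] (k ℤ.+ + 0))
  where
  coeffZ-[] : ∀ j → coeffZ [] j ≡ 0ℤ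
  coeffZ-[] (+ m)    = refl
  coeffZ-[] -[1+ _ ] = refl

,-cong : ∀ {s t p q} → s ≡ t → p ≈ₚ q → (s , p) ≈ₗ (t , q)
,-cong {s} {_} {p} {q} refl e = mk≈ₗ λ k →
  trans (coeffL-coeffZ s p k) (trans (coeffZ-cong e (k ℤ.+ + s)) (sym (coeffL-coeffZ s q k)))

shiftUp-cancel : ∀ s k p → ((s ℕ.+ k) , shiftUp k p) ≈ₗ (s , p)
shiftUp-cancel s k p = mk≈ₗ λ j → begin
  coeffL ((s ℕ.+ k) , shiftUp k p) j        ≡⟨ coeffL-coeffZ (s ℕ.+ k) (shiftUp k p) j ⟩
  coeffZ (shiftUp k p) (j ℤ.+ + (s ℕ.+ k))  ≡⟨ coeffZ-shiftUp k p (j ℤ.+ + (s ℕ.+ k)) ⟩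
  coeffZ p (j ℤ.+ + (s ℕ.+ k) ℤ.- + k)      ≡⟨ cong (λ z → coeffZ p (j ℤ.+ z ℤ.- + k)) (ℤP.pos-+ s k) ⟩
  coeffZ p (j ℤ.+ (+ s ℤ.+ + k) ℤ.- + k)    ≡⟨ cong (coeffZ p) (cancel j (+ s) (+ k)) ⟩
  coeffZ p (j ℤ.+ + s)                      ≡⟨ coeffL-coeffZ s p j ⟨
  coeffL (s , p) j                          ∎
  where
  open ≡-Reasoning
  cancel : ∀ j s k → j ℤ.+ (s ℤ.+ k) ℤ.- k ≡ j ℤ.+ s
  cancel = ℤ-Solver.solve-∀

≈ₗ⇒shiftUp-≈ₚ : ∀ {s p t q} → (s , p) ≈ₗ (t , q) → shiftUp t p ≈ₚ shiftUp s q
≈ₗ⇒shiftUp-≈ₚ {s} {p} {t} {q} e = mk≈ₚ go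
  where
  open ≡-Reasoning
  shift₁ : ∀ i t s → i ℤ.- t ℤ.- s ℤ.+ s ≡ i ℤ.- t
  shift₁ = ℤ-Solver.solve-∀
  shift₂ : ∀ i t s → i ℤ.- t ℤ.- s ℤ.+ t ≡ i ℤ.- s
  shift₂ = ℤ-Solver.solve-∀
  go : ∀ i → coeff (shiftUp t p) i ≡ coeff (shiftUp s q) i
  go i = begin
    coeff (shiftUp t p) i            ≡⟨ coeffZ-shiftUp t p (+ i) ⟩
    coeffZ p (+ i ℤ.- + t)           ≡⟨ cong (coeffZ p) (shift₁ (+ i) (+ t) (+ s)) ⟨
    coeffZ p (k ℤ.+ + s)             ≡⟨ coeffL-coeffZ s p k ⟨
    coeffL (s , p) k                 ≡⟨ coeffL-≈ₗ e k ⟩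
    coeffL (t , q) k                 ≡⟨ coeffL-coeffZ t q k ⟩
    coeffZ q (k ℤ.+ + t)             ≡⟨ cong (coeffZ q) (shift₂ (+ i) (+ t) (+ s)) ⟩
    coeffZ q (+ i ℤ.- + s)           ≡⟨ coeffZ-shiftUp s q (+ i) ⟨
    coeff (shiftUp s q) i            ∎
    where k = + i ℤ.- + t ℤ.- + s

+L-cong : ∀ {a a′ b b′} → a ≈ₗ a′ → b ≈ₗ b′ → a +L b ≈ₗ a′ +L b′
+L-cong {a} {a′} {b} {b′} e f = mk≈ₗ λ k →
  trans (coeffL-+L a b k) (trans (cong₂ ℤ._+_ (coeffL-≈ₗ e k) (coeffL-≈ₗ f k)) (sym (coeffL-+L a′ b′ k)))

-L-cong : ∀ {a a′} → a ≈ₗ a′ → -L a ≈ₗ -L a′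
-L-cong {a} {a′} e = mk≈ₗ λ k →
  trans (coeffL-neg a k) (trans (cong ℤ.-_ (coeffL-≈ₗ e k)) (sym (coeffL-neg a′ k)))

+L-assoc : ∀ a b c → (a +L b) +L c ≈ₗ a +L (b +L c)
+L-assoc a b c = mk≈ₗ λ k → begin
  coeffL ((a +L b) +L c) k                          ≡⟨ coeffL-+L (a +L b) c k ⟩
  coeffL (a +L b) k ℤ.+ coeffL c k                  ≡⟨ cong (ℤ._+ coeffL c k) (coeffL-+L a b k) ⟩
  (coeffL a k ℤ.+ coeffL b k) ℤ.+ coeffL c k        ≡⟨ ℤP.+-assoc (coeffL a k) _ _ ⟩
  coeffL a k ℤ.+ (coeffL b k ℤ.+ coeffL c k)        ≡⟨ cong (λ z → coeffL a k ℤ.+ z) (coeffL-+L b c k) ⟨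
  coeffL a k ℤ.+ coeffL (b +L c) k                  ≡⟨ coeffL-+L a (b +L c) k ⟨
  coeffL (a +L (b +L c)) k                          ∎
  where open ≡-Reasoning

+L-comm : ∀ a b → a +L b ≈ₗ b +L a
+L-comm a b = mk≈ₗ λ k →
  trans (coeffL-+L a b k) (trans (ℤP.+-comm (coeffL a k) _) (sym (coeffL-+L b a k)))

+L-identityˡ : ∀ a → 0L +L a ≈ₗ a
+L-identityˡ a = mk≈ₗ λ k →
  trans (coeffL-+L 0L a k) (trans (cong (ℤ._+ coeffL a k) (coeffL-0L k)) (ℤP.+-identityˡ _))

+L-identityʳ : ∀ a → a +L 0L ≈ₗ a
+L-identityʳ a = ≈ₗ-trans (+L-comm a 0L) (+L-identityˡ a)

-L-inverseˡ : ∀ a → (-L a) +L a ≈ₗ 0L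
-L-inverseˡ a = mk≈ₗ λ k → begin
  coeffL ((-L a) +L a) k              ≡⟨ coeffL-+L (-L a) a k ⟩
  coeffL (-L a) k ℤ.+ coeffL a k      ≡⟨ cong (ℤ._+ coeffL a k) (coeffL-neg a k) ⟩
  ℤ.- coeffL a k ℤ.+ coeffL a k       ≡⟨ ℤP.+-inverseˡ (coeffL a k) ⟩
  0ℤ                                  ≡⟨ coeffL-0L k ⟨
  coeffL 0L k                         ∎
  where open ≡-Reasoning

-L-inverseʳ : ∀ a → a +L (-L a) ≈ₗ 0L
-L-inverseʳ a = ≈ₗ-trans (+L-comm a (-L a)) (-L-inverseˡ a)

*L-comm : ∀ a b → a *L b ≈ₗ b *L a
*L-comm (s , p) (t , q) = ,-cong (ℕP.+-comm s t) (*p-comm p q)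

*L-assoc : ∀ a b c → (a *L b) *L c ≈ₗ a *L (b *L c)
*L-assoc (s , p) (t , q) (u , r) = ,-cong (ℕP.+-assoc s t u) (*p-assoc p q r)

*L-identityˡ : ∀ a → 1L *L a ≈ₗ a
*L-identityˡ (s , p) = ,-cong refl (*p-identityˡ p)

*L-identityʳ : ∀ a → a *L 1L ≈ₗ a
*L-identityʳ a = ≈ₗ-trans (*L-comm a 1L) (*L-identityˡ a)

*L-congˡ : ∀ {a a′} → a ≈ₗ a′ → ∀ b → a *L b ≈ₗ a′ *L b
*L-congˡ {s , p} {s′ , p′} e (t , q) =
  ≈ₗ-trans (≈ₗ-sym (shiftUp-cancel (s ℕ.+ t) s′ (p *p q)))
  (≈ₗ-trans (,-cong (reorder s t s′) (≈ₚ-trans (≈ₚ-sym (shiftUp-*pˡ s′ p q))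
                                    (≈ₚ-trans (*p-congˡ (≈ₗ⇒shiftUp-≈ₚ e) q) (shiftUp-*pˡ s p′ q))))
  (shiftUp-cancel (s′ ℕ.+ t) s (p′ *p q)))
  where
  reorder : ∀ s t s′ → s ℕ.+ t ℕ.+ s′ ≡ s′ ℕ.+ t ℕ.+ s
  reorder = ℕ-Solver.solve-∀

*L-cong : ∀ {a a′ b b′} → a ≈ₗ a′ → b ≈ₗ b′ → a *L b ≈ₗ a′ *L b′
*L-cong {a} {a′} {b} {b′} e f =
  ≈ₗ-trans (*L-congˡ e b) (≈ₗ-trans (*L-comm a′ b) (≈ₗ-trans (*L-congˡ f a′) (*L-comm b′ a′)))

*L-distribˡ : ∀ a b c → a *L (b +L c) ≈ₗ (a *L b) +L (a *L c)
*L-distribˡ (s , p) (t , q) (u , r) =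
  ≈ₗ-trans (≈ₗ-sym (shiftUp-cancel (s ℕ.+ (t ℕ.+ u)) s (p *p (shiftUp u q +p shiftUp t r))))
           (,-cong (reorder s t u) distribute)
  where
  reorder : ∀ s t u → s ℕ.+ (t ℕ.+ u) ℕ.+ s ≡ s ℕ.+ t ℕ.+ (s ℕ.+ u)
  reorder = ℕ-Solver.solve-∀
  shiftUp-*p : ∀ k m → shiftUp s (p *p shiftUp k m) ≈ₚ shiftUp (s ℕ.+ k) (p *p m)
  shiftUp-*p k m = ≈ₚ-trans (shiftUp-cong s (shiftUp-*pʳ k p m)) (≡⇒≈ₚ (sym (shiftUp-+ s k (p *p m))))
  distribute : shiftUp s (p *p (shiftUp u q +p shiftUp t r))
               ≈ₚ shiftUp (s ℕ.+ u) (p *p q) +p shiftUp (s ℕ.+ t) (p *p r)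
  distribute = ≈ₚ-trans (shiftUp-cong s (*p-distribˡ p (shiftUp u q) (shiftUp t r)))
               (≈ₚ-trans (shiftUp-+p s (p *p shiftUp u q) (p *p shiftUp t r))
                         (+p-cong (shiftUp-*p u q) (shiftUp-*p t r)))

*L-distribʳ : ∀ a b c → (b +L c) *L a ≈ₗ (b *L a) +L (c *L a)
*L-distribʳ a b c =
  ≈ₗ-trans (*L-comm (b +L c) a) (≈ₗ-trans (*L-distribˡ a b c) (+L-cong (*L-comm a b) (*L-comm a c)))

Laurent-commutativeRing : CommutativeRing 0ℓ 0ℓ
Laurent-commutativeRing = record
  { Carrier = Laur ; _≈_ = _≈ₗ_ ; _+_ = _+L_ ; _*_ = _*L_ ; -_ = -L_ ; 0# = 0L ; 1# = 1L
  ; isCommutativeRing = record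
    { isRing = record
      { +-isAbelianGroup = record
        { isGroup = record
          { isMonoid = record
            { isSemigroup = record
              { isMagma = record
                { isEquivalence = record { refl = ≈ₗ-refl ; sym = ≈ₗ-sym ; trans = ≈ₗ-trans }
                ; ∙-cong = +L-cong }
              ; assoc = +L-assoc }
            ; identity = +L-identityˡ , +L-identityʳ }
          ; inverse = -L-inverseˡ , -L-inverseʳ
          ; ⁻¹-cong = -L-cong }
        ; comm = +L-comm }
      ; *-cong = *L-cong
      ; *-assoc = *L-assoc
      ; *-identity = *L-identityˡ , *L-identityʳ
      ; distrib = *L-distribˡ , *L-distribʳ }
    ; *-comm = *L-comm } }

coeffZ-zeros : ∀ {p} → All (_≡ 0ℤ) p → ∀ j → coeffZ p j ≡ 0ℤ
coeffZ-zeros []          (+ _)     = refl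
coeffZ-zeros (p₀≡0 ∷ _)  (+ zero)  = p₀≡0
coeffZ-zeros (_ ∷ zeros) (+ suc i) = coeffZ-zeros zeros (+ i)
coeffZ-zeros _           -[1+ _ ]  = refl

0L≟_ : ∀ a → Maybe (0L ≈ₗ a)
0L≟ (s , p) with All.all? (ℤ._≟ 0ℤ) p
... | yes zeros = just (mk≈ₗ λ k →
        trans (coeffL-0L k) (sym (trans (coeffL-coeffZ s p k) (coeffZ-zeros zeros (k ℤ.+ + s)))))
... | no _      = nothing

-- The ring solver cancels constants only through the zero test.
Laurent-ring : AlmostCommutativeRing 0ℓ 0ℓ
Laurent-ring = fromCommutativeRing Laurent-commutativeRing 0L≟_

-- Finite sums with indicator coefficients in a commutative ring

module Sums (R : CommutativeRing 0ℓ 0ℓ) where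
  open CommutativeRing R hiding (zero)
    renaming (refl to ≈-refl; sym to ≈-sym; trans to ≈-trans)
  open import Algebra.Properties.Ring ring using (-‿+-comm; -0#≈0#)
  open import Relation.Binary.Reasoning.Setoid setoid

  Σ : {A : Set} → List A → (A → Carrier) → Carrier
  Σ xs f = foldr (λ a acc → f a + acc) 0# xs

  ind : {A : Set} → Dec A → Carrier → Carrier
  ind d c = if does d then c else 0#

  Σ-cong : {A : Set} (xs : List A) {f g : A → Carrier} → (∀ x → f x ≈ g x) → Σ xs f ≈ Σ xs g
  Σ-cong []       e = ≈-refl
  Σ-cong (x ∷ xs) e = +-cong (e x) (Σ-cong xs e)

  Σ-zero : {A : Set} (xs : List A) {f : A → Carrier} → (∀ x → f x ≈ 0#) → Σ xs f ≈ 0#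
  Σ-zero []       e = ≈-refl
  Σ-zero (x ∷ xs) e = ≈-trans (+-cong (e x) (Σ-zero xs e)) (+-identityˡ 0#)

  Σ-+ : {A : Set} (xs : List A) (f g : A → Carrier) → Σ xs (λ x → f x + g x) ≈ Σ xs f + Σ xs g
  Σ-+ []       f g = ≈-sym (+-identityˡ 0#)
  Σ-+ (x ∷ xs) f g = ≈-trans (+-congˡ (Σ-+ xs f g)) (interchange (f x) (g x) _ _)
    where open import Algebra.Properties.CommutativeSemigroup +-commutativeSemigroup using (interchange)

  Σ-*ˡ : {A : Set} (xs : List A) (c : Carrier) (f : A → Carrier) → c * Σ xs f ≈ Σ xs (λ x → c * f x)
  Σ-*ˡ []       c f = zeroʳ c
  Σ-*ˡ (x ∷ xs) c f = ≈-trans (distribˡ c (f x) _) (+-congˡ (Σ-*ˡ xs c f))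

  Σ-*ʳ : {A : Set} (xs : List A) (c : Carrier) (f : A → Carrier) → Σ xs f * c ≈ Σ xs (λ x → f x * c)
  Σ-*ʳ xs c f = ≈-trans (*-comm _ c) (≈-trans (Σ-*ˡ xs c f) (Σ-cong xs (λ x → *-comm c (f x))))

  -‿Σ : {A : Set} (xs : List A) (f : A → Carrier) → - Σ xs f ≈ Σ xs (λ x → - f x)
  -‿Σ []       f = -0#≈0#
  -‿Σ (x ∷ xs) f = ≈-trans (≈-sym (-‿+-comm (f x) _)) (+-congˡ (-‿Σ xs f))

  Σ-swap : {A B : Set} (xs : List A) (ys : List B) (f : A → B → Carrier) →
           Σ xs (λ x → Σ ys (f x)) ≈ Σ ys (λ y → Σ xs (λ x → f x y))
  Σ-swap []       ys f = ≈-sym (Σ-zero ys (λ _ → ≈-refl))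
  Σ-swap (x ∷ xs) ys f =
    ≈-trans (+-congˡ (Σ-swap xs ys f)) (≈-sym (Σ-+ ys (f x) (λ y → Σ xs (λ x → f x y))))

  Σ-filter : {A : Set} {P : Pred A 0ℓ} (P? : U.Decidable P) (xs : List A) (f : A → Carrier) →
             Σ (filter P? xs) f ≈ Σ xs (λ x → ind (P? x) (f x))
  Σ-filter P? []       f = ≈-refl
  Σ-filter P? (x ∷ xs) f with P? x
  ... | yes _ = +-congˡ (Σ-filter P? xs f)
  ... | no  _ = ≈-trans (Σ-filter P? xs f) (≈-sym (+-identityˡ _))

  ind-yes : {A : Set} (d : Dec A) → A → ∀ c → ind d c ≈ c
  ind-yes (yes _) a  c = ≈-refl
  ind-yes (no ¬a) a  c = contradiction a ¬a

  ind-no : {A : Set} (d : Dec A) → ¬ A → ∀ c → ind d c ≈ 0#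
  ind-no (yes a) ¬a c = contradiction a ¬a
  ind-no (no _)  ¬a c = ≈-refl

  ind-cong : {A : Set} (d : Dec A) {c c′ : Carrier} → (A → c ≈ c′) → ind d c ≈ ind d c′
  ind-cong (yes a) e = e a
  ind-cong (no _)  e = ≈-refl

  ind-⇔ : {A B : Set} (d : Dec A) (e : Dec B) → (A → B) → (B → A) → ∀ c → ind d c ≈ ind e c
  ind-⇔ (yes a) e f g c = ≈-sym (ind-yes e (f a) c)
  ind-⇔ (no ¬a) e f g c = ≈-sym (ind-no e (λ b → ¬a (g b)) c)

  ind-ind : {A B : Set} (d : Dec A) (e : Dec B) (c : Carrier) → ind d (ind e c) ≈ ind (d ×-dec e) c
  ind-ind (yes _) (yes _) c = ≈-refl
  ind-ind (yes _) (no _)  c = ≈-refl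
  ind-ind (no _)  e       c = ≈-refl

  ind-*ˡ : {A : Set} (d : Dec A) (c x : Carrier) → c * ind d x ≈ ind d (c * x)
  ind-*ˡ (yes _) c x = ≈-refl
  ind-*ˡ (no _)  c x = zeroʳ c

  ind-*ʳ : {A : Set} (d : Dec A) (x c : Carrier) → ind d x * c ≈ ind d (x * c)
  ind-*ʳ (yes _) x c = ≈-refl
  ind-*ʳ (no _)  x c = zeroˡ c

  ind-+ : {A : Set} (d : Dec A) (x y : Carrier) → ind d (x + y) ≈ ind d x + ind d y
  ind-+ (yes _) x y = ≈-refl
  ind-+ (no _)  x y = ≈-sym (+-identityˡ 0#)

  ind-neg : {A : Set} (d : Dec A) (x : Carrier) → ind d (- x) ≈ - ind d x
  ind-neg (yes _) x = ≈-refl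
  ind-neg (no _)  x = ≈-sym -0#≈0#

  ind-Σ : {A B : Set} (d : Dec A) (xs : List B) (f : B → Carrier) →
          ind d (Σ xs f) ≈ Σ xs (λ z → ind d (f z))
  ind-Σ (yes _) xs f = ≈-refl
  ind-Σ (no _)  xs f = ≈-sym (Σ-zero xs (λ _ → ≈-refl))

  Σ-ind-zero : {A : Set} {P : Pred A 0ℓ} (P? : U.Decidable P) (xs : List A) {f : A → Carrier} →
               (∀ x → P x → f x ≈ 0#) → Σ xs (λ x → ind (P? x) (f x)) ≈ 0#
  Σ-ind-zero P? xs f≈0 = Σ-zero xs vanish
    where
    vanish : ∀ x → ind (P? x) _ ≈ 0#
    vanish x with P? x
    ... | yes Px = f≈0 x Px
    ... | no  _  = ≈-refl

  ind-Σ-* : {A B : Set} (d : Dec A) (ys : List B) {Q : Pred B 0ℓ} (Q? : U.Decidable Q)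
            (g : B → Carrier) (c : Carrier) →
            ind d (Σ ys (λ y → ind (Q? y) (g y)) * c) ≈ Σ ys (λ y → ind (d ×-dec Q? y) (g y * c))
  ind-Σ-* d ys Q? g c = begin
    ind d (Σ ys (λ y → ind (Q? y) (g y)) * c)      ≈⟨ ind-cong d (λ _ → Σ-*ʳ ys c _) ⟩
    ind d (Σ ys (λ y → ind (Q? y) (g y) * c))      ≈⟨ ind-cong d (λ _ → Σ-cong ys (λ y → ind-*ʳ (Q? y) (g y) c)) ⟩
    ind d (Σ ys (λ y → ind (Q? y) (g y * c)))      ≈⟨ ind-Σ d ys _ ⟩
    Σ ys (λ y → ind d (ind (Q? y) (g y * c)))      ≈⟨ Σ-cong ys (λ y → ind-ind d (Q? y) _) ⟩
    Σ ys (λ y → ind (d ×-dec Q? y) (g y * c))      ∎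

  Σ-ind-Σ-swap : {A B : Set} (xs : List A) (ys : List B)
                 {P : A → Set} {Q : A → B → Set} {P′ : B → Set} {Q′ : B → A → Set}
                 (P? : ∀ x → Dec (P x)) (Q? : ∀ x y → Dec (Q x y))
                 (P′? : ∀ y → Dec (P′ y)) (Q′? : ∀ y x → Dec (Q′ y x)) →
                 (∀ x y → P x × Q x y → P′ y × Q′ y x) → (∀ x y → P′ y × Q′ y x → P x × Q x y) →
                 (f : A → Carrier) (g : B → Carrier) →
                 Σ xs (λ x → ind (P? x) (Σ ys (λ y → ind (Q? x y) (g y)) * f x))
                 ≈ Σ ys (λ y → ind (P′? y) (Σ xs (λ x → ind (Q′? y x) (f x)) * g y))
  Σ-ind-Σ-swap xs ys P? Q? P′? Q′? to from f g = begin
    Σ xs (λ x → ind (P? x) (Σ ys (λ y → ind (Q? x y) (g y)) * f x))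
      ≈⟨ Σ-cong xs (λ x → ind-Σ-* (P? x) ys (Q? x) g (f x)) ⟩
    Σ xs (λ x → Σ ys (λ y → ind (P? x ×-dec Q? x y) (g y * f x)))
      ≈⟨ Σ-swap xs ys _ ⟩
    Σ ys (λ y → Σ xs (λ x → ind (P? x ×-dec Q? x y) (g y * f x)))
      ≈⟨ Σ-cong ys (λ y → Σ-cong xs (λ x →
           ≈-trans (ind-⇔ (P? x ×-dec Q? x y) (P′? y ×-dec Q′? y x) (to x y) (from x y) _)
                   (ind-cong (P′? y ×-dec Q′? y x) (λ _ → *-comm (g y) (f x))))) ⟩
    Σ ys (λ y → Σ xs (λ x → ind (P′? y ×-dec Q′? y x) (f x * g y)))
      ≈⟨ Σ-cong ys (λ y → ind-Σ-* (P′? y) xs (Q′? y) f (g y)) ⟨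
    Σ ys (λ y → ind (P′? y) (Σ xs (λ x → ind (Q′? y x) (f x)) * g y))
      ∎

  Σ-map : {A B : Set} (g : A → B) (xs : List A) (f : B → Carrier) → Σ (map g xs) f ≡ Σ xs (f ∘ g)
  Σ-map g []       f = ≡.refl
  Σ-map g (x ∷ xs) f = ≡.cong (λ s → f (g x) + s) (Σ-map g xs f)

  Σ-allFin-suc : ∀ n (f : Fin (suc n) → Carrier) → Σ (allFin (suc n)) f ≡ f zero + Σ (allFin n) (f ∘ suc)
  Σ-allFin-suc n f = ≡.cong (λ s → f zero + s)
    (≡.trans (≡.cong (λ xs → Σ xs f) (≡.sym (map-tabulate id suc))) (Σ-map suc (allFin n) f))

  Σ-allFin-≟ : ∀ n (a : Fin n) (f : Fin n → Carrier) → Σ (allFin n) (λ x → ind (x ≟F a) (f x)) ≈ f a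
  Σ-allFin-≟ (suc n) zero    f = begin
    Σ (allFin (suc n)) (λ x → ind (x ≟F zero) (f x))   ≡⟨ Σ-allFin-suc n _ ⟩
    f zero + Σ (allFin n) (λ _ → 0#)                     ≈⟨ +-congˡ (Σ-zero (allFin n) (λ _ → ≈-refl)) ⟩
    f zero + 0#                                          ≈⟨ +-identityʳ _ ⟩
    f zero                                               ∎
  Σ-allFin-≟ (suc n) (suc a) f = begin
    Σ (allFin (suc n)) (λ x → ind (x ≟F suc a) (f x))  ≡⟨ Σ-allFin-suc n _ ⟩
    0# + Σ (allFin n) (λ x → ind (x ≟F a) (f (suc x)))  ≈⟨ +-identityˡ _ ⟩
    Σ (allFin n) (λ x → ind (x ≟F a) (f (suc x)))       ≈⟨ Σ-allFin-≟ n a (f ∘ suc) ⟩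
    f (suc a)                                            ∎

  Σ-allFin-unique : ∀ n {A : Pred (Fin n) 0ℓ} (A? : U.Decidable A) (a : Fin n) (f : Fin n → Carrier) →
                    (∀ x → A x → x ≡ a) → A a → Σ (allFin n) (λ x → ind (A? x) (f x)) ≈ f a
  Σ-allFin-unique n A? a f unique Aa =
    ≈-trans (Σ-cong (allFin n) (λ x → ind-⇔ (A? x) (x ≟F a) (unique x) (λ { refl → Aa }) (f x)))
            (Σ-allFin-≟ n a f)

  Σ-allFin-split : ∀ n {A B : Pred (Fin n) 0ℓ} (A? : U.Decidable A) (B? : U.Decidable B)
                   (a : Fin n) (f : Fin n → Carrier) →
                   (∀ x → A x → x ≡ a ⊎ B x) → (∀ x → B x → A x) → A a → ¬ B a →
                   Σ (allFin n) (λ x → ind (A? x) (f x)) ≈ f a + Σ (allFin n) (λ x → ind (B? x) (f x))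
  Σ-allFin-split n A? B? a f A⇒a⊎B B⇒A Aa ¬Ba = begin
    Σ (allFin n) (λ x → ind (A? x) (f x))
      ≈⟨ Σ-cong (allFin n) split ⟩
    Σ (allFin n) (λ x → ind (x ≟F a) (f x) + ind (B? x) (f x))
      ≈⟨ Σ-+ (allFin n) _ _ ⟩
    Σ (allFin n) (λ x → ind (x ≟F a) (f x)) + Σ (allFin n) (λ x → ind (B? x) (f x))
      ≈⟨ +-congʳ (Σ-allFin-≟ n a f) ⟩
    f a + Σ (allFin n) (λ x → ind (B? x) (f x))
      ∎
    where
    split : ∀ x → ind (A? x) (f x) ≈ ind (x ≟F a) (f x) + ind (B? x) (f x)
    split x with x ≟F a
    ... | yes refl = ≈-trans (ind-yes (A? x) Aa (f x))
                             (≈-sym (≈-trans (+-congˡ (ind-no (B? x) ¬Ba (f x))) (+-identityʳ (f x))))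
    ... | no x≢a   =
      ≈-trans (ind-⇔ (A? x) (B? x) (λ Ax → [ (λ x≡a → contradiction x≡a x≢a) , id ]′ (A⇒a⊎B x Ax))
                     (B⇒A x) (f x))
              (≈-sym (+-identityˡ _))

module ℤΣ = Sums ℤP.+-*-commutativeRing
module ℒΣ = Sums Laurent-commutativeRing

module ℒ = CommutativeRing Laurent-commutativeRing
open import Algebra.Properties.Ring ℒ.ring using (-1*x≈-x)

yL : Laur
yL = xL -L 1L

constL-* : ∀ a b → constL (a ℤ.* b) ≈ₗ constL a *L constL b
constL-* a b = ,-cong refl (∷-cong (sym (ℤP.+-identityʳ _)) ≈ₚ-refl)

constL-0 : constL 0ℤ ≈ₗ 0L
constL-0 = ,-cong refl (∷-≈ₚ[] refl ≈ₚ-refl)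

constL-neg : ∀ a → constL (ℤ.- a) ≈ₗ -L constL a
constL-neg a = ,-cong refl (∷-cong (sym (ℤP.-1*i≡-i a)) ≈ₚ-refl)

constL-Σ : {A : Set} (xs : List A) (f : A → ℤ) → constL (ℤΣ.Σ xs f) ≈ₗ ℒΣ.Σ xs (constL ∘ f)
constL-Σ []       f = constL-0
constL-Σ (x ∷ xs) f = +L-cong (≈ₗ-refl {constL (f x)}) (constL-Σ xs f)

constL-ind : {A : Set} (d : Dec A) (c : ℤ) → constL (ℤΣ.ind d c) ≈ₗ ℒΣ.ind d (constL c)
constL-ind (yes _) c = ≈ₗ-refl
constL-ind (no _)  c = constL-0

^L-cong : ∀ {a b} n → a ≈ₗ b → a ^L n ≈ₗ b ^L n
^L-cong zero    e = ≈ₗ-refl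
^L-cong (suc n) e = *L-cong e (^L-cong n e)

^L-+ : ∀ a m n → a ^L (m ℕ.+ n) ≈ₗ a ^L m *L a ^L n
^L-+ a zero    n = ≈ₗ-sym (*L-identityˡ _)
^L-+ a (suc m) n = ≈ₗ-trans (*L-cong (≈ₗ-refl {a}) (^L-+ a m n)) (≈ₗ-sym (*L-assoc a _ _))

^L-* : ∀ a b n → (a *L b) ^L n ≈ₗ a ^L n *L b ^L n
^L-* a b zero    = ≈ₗ-sym (*L-identityˡ _)
^L-* a b (suc n) = ≈ₗ-trans (*L-cong (≈ₗ-refl {a *L b}) (^L-* a b n)) (interchange a b _ _)
  where
  interchange : ∀ a b c d → (a *L b) *L (c *L d) ≈ₗ (a *L c) *L (b *L d)
  interchange = Solver.solve-∀ Laurent-ring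

x+y≈z⇒y≈z-x : ∀ {x y z} → x +L y ≈ₗ z → y ≈ₗ z -L x
x+y≈z⇒y≈z-x {x} {y} x+y≈z = ≈ₗ-trans (add-sub x y) (+L-cong x+y≈z (≈ₗ-refl { -L x}))
  where
  add-sub : ∀ x y → y ≈ₗ (x +L y) -L x
  add-sub = Solver.solve-∀ Laurent-ring

-‿^L : ∀ a n → (-L a) ^L n ≈ₗ -L ((-L 1L) ^L suc n *L a ^L n)
-‿^L a zero    = base a
  where
  base : ∀ a → 1L ≈ₗ -L (((-L 1L) *L 1L) *L 1L)
  base = Solver.solve-∀ Laurent-ring
-‿^L a (suc n) = ≈ₗ-trans (*L-cong (≈ₗ-refl { -L a}) (-‿^L a n)) (step a ((-L 1L) ^L suc n) (a ^L n))
  where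
  step : ∀ a v w → (-L a) *L (-L (v *L w)) ≈ₗ -L (((-L 1L) *L v) *L (a *L w))
  step = Solver.solve-∀ Laurent-ring

xL*xinvL : xL *L xinvL ≈ₗ 1L
xL*xinvL = ≈ₗ-trans (,-cong refl (mk≈ₚ λ { zero → refl ; (suc zero) → refl ; (suc (suc i)) → refl }))
                    (shiftUp-cancel 0 1 (1ℤ ∷ []))

evalAt-+p : ∀ p q z → evalAt (p +p q) z ≈ₗ evalAt p z +L evalAt q z
evalAt-+p []      q       z = ≈ₗ-sym (+L-identityˡ _)
evalAt-+p (a ∷ p) []      z = ≈ₗ-sym (+L-identityʳ _)
evalAt-+p (a ∷ p) (b ∷ q) z =
  ≈ₗ-trans (+L-cong (≈ₗ-refl {constL (a ℤ.+ b)}) (*L-cong (≈ₗ-refl {z}) (evalAt-+p p q z)))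
           (regroup (constL a) (constL b) (evalAt p z) (evalAt q z) z)
  where
  regroup : ∀ a b e f z → (a +L b) +L z *L (e +L f) ≈ₗ (a +L z *L e) +L (b +L z *L f)
  regroup = Solver.solve-∀ Laurent-ring

evalAt-scale : ∀ c p z → evalAt (scale c p) z ≈ₗ constL c *L evalAt p z
evalAt-scale c []      z = ≈ₗ-sym (ℒ.zeroʳ (constL c))
evalAt-scale c (a ∷ p) z =
  ≈ₗ-trans (+L-cong (constL-* c a) (*L-cong (≈ₗ-refl {z}) (evalAt-scale c p z)))
           (factor (constL c) (constL a) z (evalAt p z))
  where
  factor : ∀ c a z e → c *L a +L z *L (c *L e) ≈ₗ c *L (a +L z *L e)
  factor = Solver.solve-∀ Laurent-ring

evalAt-*p : ∀ p q z → evalAt (p *p q) z ≈ₗ evalAt p z *L evalAt q z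
evalAt-*p []      q z = ≈ₗ-sym (ℒ.zeroˡ (evalAt q z))
evalAt-*p (a ∷ p) q z =
  ≈ₗ-trans (evalAt-+p (scale a q) (0ℤ ∷ (p *p q)) z)
  (≈ₗ-trans (+L-cong (evalAt-scale a q z)
                     (≈ₗ-trans (+L-cong constL-0 (*L-cong (≈ₗ-refl {z}) (evalAt-*p p q z))) (+L-identityˡ _)))
            (factor (constL a) z (evalAt p z) (evalAt q z)))
  where
  factor : ∀ a z e f → a *L f +L z *L (e *L f) ≈ₗ (a +L z *L e) *L f
  factor = Solver.solve-∀ Laurent-ring

evalAt-1 : ∀ z → evalAt (1ℤ ∷ []) z ≈ₗ 1L
evalAt-1 z = ≈ₗ-trans (+L-cong (≈ₗ-refl {1L}) (ℒ.zeroʳ z)) (+L-identityʳ 1L)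

evalAt-yₚ : ∀ z → evalAt yₚ z ≈ₗ z -L 1L
evalAt-yₚ z = ≈ₗ-trans (+L-cong (≈ₗ-refl { -L 1L}) (*L-cong (≈ₗ-refl {z}) (evalAt-1 z))) (rearrange z)
  where
  rearrange : ∀ z → -L 1L +L z *L 1L ≈ₗ z -L 1L
  rearrange = Solver.solve-∀ Laurent-ring

poly-powP-yₚ : ∀ P n → poly (powP P yₚ n) ≈ₗ yL ^L n
poly-powP-yₚ P zero    = ≈ₗ-refl
poly-powP-yₚ P (suc n) = *L-cong (≈ₗ-refl {yL}) (poly-powP-yₚ P n)

evalAt-powP-yₚ : ∀ P n z → evalAt (powP P yₚ n) z ≈ₗ (z -L 1L) ^L n
evalAt-powP-yₚ P zero    z = evalAt-1 z
evalAt-powP-yₚ P (suc n) z =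
  ≈ₗ-trans (evalAt-*p yₚ (powP P yₚ n) z) (*L-cong (evalAt-yₚ z) (evalAt-powP-yₚ P n z))

x*[x⁻¹-1]≈-y : xL *L (xinvL -L 1L) ≈ₗ -L yL
x*[x⁻¹-1]≈-y =
  ≈ₗ-trans (expand xL xinvL)
           (≈ₗ-trans (+L-cong (≈ₗ-refl { -L yL}) (+L-cong xL*xinvL (≈ₗ-refl { -L 1L}))) (cancel (-L yL)))
  where
  expand : ∀ x x⁻¹ → x *L (x⁻¹ -L 1L) ≈ₗ -L (x -L 1L) +L (x *L x⁻¹ -L 1L)
  expand = Solver.solve-∀ Laurent-ring
  cancel : ∀ a → a +L (1L -L 1L) ≈ₗ a
  cancel = Solver.solve-∀ Laurent-ring

x^r*evalAt-x⁻¹ : ∀ P g {m r} → m ℕ.≤ r →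
  xL ^L r *L evalAt (g *p powP P yₚ (r ∸ m)) xinvL ≈ₗ (-L yL) ^L (r ∸ m) *L evalAt g xinvL *L xL ^L m
x^r*evalAt-x⁻¹ P g {m} {r} m≤r = begin
  xL ^L r *L evalAt (g *p powP P yₚ k) xinvL
    ≈⟨ *L-cong (≈ₗ-trans (≡⇒≈ₗ (cong (xL ^L_) (sym (ℕP.m+[n∸m]≡n m≤r)))) (^L-+ xL m k))
               (≈ₗ-trans (evalAt-*p g (powP P yₚ k) xinvL)
                         (*L-cong (≈ₗ-refl {evalAt g xinvL}) (evalAt-powP-yₚ P k xinvL))) ⟩
  (xL ^L m *L xL ^L k) *L (evalAt g xinvL *L (xinvL -L 1L) ^L k)
    ≈⟨ regroup (xL ^L m) (xL ^L k) (evalAt g xinvL) ((xinvL -L 1L) ^L k) ⟩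
  (xL ^L k *L (xinvL -L 1L) ^L k) *L evalAt g xinvL *L xL ^L m
    ≈⟨ *L-cong (*L-cong (≈ₗ-trans (≈ₗ-sym (^L-* xL (xinvL -L 1L) k)) (^L-cong k x*[x⁻¹-1]≈-y))
                        (≈ₗ-refl {evalAt g xinvL}))
               (≈ₗ-refl {xL ^L m}) ⟩
  (-L yL) ^L k *L evalAt g xinvL *L xL ^L m
    ∎
  where
  open import Relation.Binary.Reasoning.Setoid ℒ.setoid
  k = r ∸ m
  regroup : ∀ a b c e → (a *L b) *L (c *L e) ≈ₗ (b *L e) *L c *L a
  regroup = Solver.solve-∀ Laurent-ring

poly-Σ : {A : Set} (xs : List A) (f : A → Poly) → poly (foldr _+p_ [] (map f xs)) ≈ₗ ℒΣ.Σ xs (poly ∘ f)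
poly-Σ []       f = ≈ₗ-refl
poly-Σ (x ∷ xs) f = +L-cong (≈ₗ-refl {poly (f x)}) (poly-Σ xs f)

evalAt-Σ : {A : Set} (xs : List A) (f : A → Poly) (z : Laur) →
           evalAt (foldr _+p_ [] (map f xs)) z ≈ₗ ℒΣ.Σ xs (λ a → evalAt (f a) z)
evalAt-Σ []       f z = ≈ₗ-refl
evalAt-Σ (x ∷ xs) f z = ≈ₗ-trans (evalAt-+p (f x) _ z) (+L-cong ≈ₗ-refl (evalAt-Σ xs f z))

-- Graded posets

length-filter-mono : {A : Set} {P Q : Pred A 0ℓ} (P? : U.Decidable P) (Q? : U.Decidable Q) →
                     (∀ x → P x → Q x) → ∀ xs → length (filter P? xs) ℕ.≤ length (filter Q? xs)
length-filter-mono P? Q? P⇒Q []       = z≤n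
length-filter-mono P? Q? P⇒Q (x ∷ xs) with P? x | Q? x
... | yes Px | no ¬Qx = contradiction (P⇒Q x Px) ¬Qx
... | yes _  | yes _  = s≤s (length-filter-mono P? Q? P⇒Q xs)
... | no _   | yes _  = ℕP.m≤n⇒m≤1+n (length-filter-mono P? Q? P⇒Q xs)
... | no _   | no _   = length-filter-mono P? Q? P⇒Q xs

length-filter-< : {A : Set} {P Q : Pred A 0ℓ} (P? : U.Decidable P) (Q? : U.Decidable Q) →
                  (∀ x → P x → Q x) → ∀ {z} xs → z ∈ xs → Q z → ¬ P z →
                  length (filter P? xs) ℕ.< length (filter Q? xs)
length-filter-< P? Q? P⇒Q (x ∷ xs) (here refl) Qz ¬Pz with P? x | Q? x
... | yes Px | _      = contradiction Px ¬Pz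
... | no _   | no ¬Qx = contradiction Qz ¬Qx
... | no _   | yes _  = s≤s (length-filter-mono P? Q? P⇒Q xs)
length-filter-< P? Q? P⇒Q (x ∷ xs) (there z∈xs) Qz ¬Pz with P? x | Q? x
... | yes Px | no ¬Qx = contradiction (P⇒Q x Px) ¬Qx
... | yes _  | yes _  = s≤s (length-filter-< P? Q? P⇒Q xs z∈xs Qz ¬Pz)
... | no _   | yes _  = ℕP.m≤n⇒m≤1+n (length-filter-< P? Q? P⇒Q xs z∈xs Qz ¬Pz)
... | no _   | no _   = length-filter-< P? Q? P⇒Q xs z∈xs Qz ¬Pz

Σℤ-cong-local : {A : Set} {f g : A → ℤ} {xs : List A} → All (λ x → f x ≡ g x) xs → Σℤ xs f ≡ Σℤ xs g
Σℤ-cong-local []        = refl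
Σℤ-cong-local (e ∷ eqs) = cong₂ ℤ._+_ e (Σℤ-cong-local eqs)

[m∸n]+[n∸o]≡m∸o : ∀ {m n o} → o ℕ.≤ n → n ℕ.≤ m → (m ∸ n) ℕ.+ (n ∸ o) ≡ m ∸ o
[m∸n]+[n∸o]≡m∸o {m} {n} {o} o≤n n≤m =
  trans (sym (ℕP.+-∸-assoc (m ∸ n) o≤n)) (cong (_∸ o) (ℕP.m∸n+n≡m n≤m))

module _ (P : GradedPoset) where
  open GradedPoset P

  infix 4 _⊏_ _⊏?_
  _⊏_ : Fin size → Fin size → Set
  _⊏_ = _<_ P

  _⊏?_ : ∀ x y → Dec (x ⊏ y)
  _⊏?_ = _<?_ P

  E : List (Fin size)
  E = elems P

  _∈[_,_]? : ∀ z a b → Dec (a ≤ z × z ≤ b)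
  z ∈[ a , b ]? = (a ≤? z) ×-dec (z ≤? b)

  intervalSize : Fin size → Fin size → ℕ
  intervalSize x y = length (filter (_∈[ x , y ]?) E)

  -- Induction on the size of [x,y]: an interior point z splits it into two
  -- smaller intervals; without one, y covers x.
  ρ-<-bounded : ∀ n {x y} → intervalSize x y ℕ.≤ n → x ⊏ y → ρ x ℕ.< ρ y
  ρ-<-bounded zero {x} {y} size≤0 (x≤y , _) =
    contradiction (ℕP.<-≤-trans (filter-some (_∈[ x , y ]?) (lose (∈-allFin x) (≤-refl x , x≤y))) size≤0)
                  (ℕP.<-irrefl refl)
  ρ-<-bounded (suc n) {x} {y} size≤1+n x⊏y@(x≤y , x≢y)
    with any? (λ z → (x ⊏? z) ×-dec (z ⊏? y)) E
  ... | yes interior =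
    let z , x⊏z@(x≤z , x≢z) , z⊏y@(z≤y , z≢y) = satisfied interior in
    ℕP.<-trans
      (ρ-<-bounded n (smaller (λ w (x≤w , w≤z) → x≤w , ≤-trans w≤z z≤y) (x≤y , ≤-refl y)
                              (λ (_ , y≤z) → z≢y (≤-antisym z≤y y≤z))) x⊏z)
      (ρ-<-bounded n (smaller (λ w (z≤w , w≤y) → ≤-trans x≤z z≤w , w≤y) (≤-refl x , x≤y)
                              (λ (z≤x , _) → x≢z (≤-antisym x≤z z≤x))) z⊏y)
    where
    smaller : ∀ {a b w} → (∀ v → a ≤ v × v ≤ b → x ≤ v × v ≤ y) →
              x ≤ w × w ≤ y → ¬ (a ≤ w × w ≤ b) → intervalSize a b ℕ.≤ n
    smaller {a} {b} {w} sub w∈[x,y] w∉[a,b] = ℕP.≤-pred (ℕP.<-≤-trans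
      (length-filter-< (_∈[ a , b ]?) (_∈[ x , y ]?) sub E (∈-allFin w) w∈[x,y] w∉[a,b]) size≤1+n)
  ... | no no-interior = ℕP.≤-reflexive (sym (ρ-cover x y x≤y x≢y covers))
    where
    covers : ∀ z → x ≤ z → z ≤ y → z ≡ x ⊎ z ≡ y
    covers z x≤z z≤y with z ≟F x | z ≟F y
    ... | yes z≡x | _       = inj₁ z≡x
    ... | no _    | yes z≡y = inj₂ z≡y
    ... | no z≢x  | no z≢y  =
      contradiction (lose (∈-allFin z) ((x≤z , λ x≡z → z≢x (sym x≡z)) , (z≤y , z≢y))) no-interior

  ρ-< : ∀ {x y} → x ⊏ y → ρ x ℕ.< ρ y
  ρ-< = ρ-<-bounded _ ℕP.≤-refl

  ρ-<-pred : ∀ {s t r} → s ⊏ t → ρ t ≡ suc r → ρ s ℕ.≤ r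
  ρ-<-pred s⊏t ρt≡1+r = ℕP.≤-pred (subst (ρ _ ℕ.<_) ρt≡1+r (ρ-< s⊏t))

  gFuel-stable : ∀ k₁ k₂ t → ρ t ℕ.≤ k₁ → ρ t ℕ.≤ k₂ → gFuel P k₁ t ≡ gFuel P k₂ t
  gFuel-stable zero     zero     t _ _ = refl
  gFuel-stable zero     (suc k₂) t h₁ _ with ρ t | h₁
  ... | zero | _ = refl
  gFuel-stable (suc k₁) zero     t _ h₂ with ρ t | h₂
  ... | zero | _ = refl
  gFuel-stable (suc k₁) (suc k₂) t h₁ h₂ with ρ t in ρt≡
  ... | zero  = refl
  ... | suc r = cong (gFromH P r) (cong (foldr _+p_ []) (map-cong-local
                  (All.map same-summand (all-filter (_⊏? t) E))))
    where
    same-summand : ∀ {s} → s ⊏ t → gFuel P k₁ s *p powP P yₚ (r ∸ ρ s) ≡ gFuel P k₂ s *p powP P yₚ (r ∸ ρ s)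
    same-summand {s} s⊏t = cong (_*p powP P yₚ (r ∸ ρ s))
      (gFuel-stable k₁ k₂ _ (ℕP.≤-trans ρs≤r (ℕP.≤-pred h₁)) (ℕP.≤-trans ρs≤r (ℕP.≤-pred h₂)))
      where ρs≤r = ρ-<-pred s⊏t ρt≡

  gFuel≡gHat : ∀ k t → ρ t ℕ.≤ k → gFuel P k t ≡ gHat P t
  gFuel≡gHat k t ρt≤k = gFuel-stable k (ρ t) t ρt≤k ℕP.≤-refl

  μfuel-stable : ∀ k₁ k₂ a b → ρ b ℕ.≤ k₁ → ρ b ℕ.≤ k₂ → μfuel P k₁ a b ≡ μfuel P k₂ a b
  μfuel-stable k₁ k₂ a b h₁ h₂ with a ≟F b
  ... | yes _ = refl
  ... | no a≢b with a ≤? b | k₁ | k₂ | h₁ | h₂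
  ...   | no _    | _      | _      | _  | _  = refl
  ...   | yes a≤b | zero   | _      | h₁ | _  = contradiction (ℕP.<-≤-trans (ρ-< (a≤b , a≢b)) h₁) λ ()
  ...   | yes a≤b | suc _  | zero   | _  | h₂ = contradiction (ℕP.<-≤-trans (ρ-< (a≤b , a≢b)) h₂) λ ()
  ...   | yes _   | suc k₁ | suc k₂ | h₁ | h₂ =
    cong ℤ.-_ (Σℤ-cong-local (All.map same (all-filter (λ z → (a ≤? z) ×-dec (z ⊏? b)) E)))
    where
    same : ∀ {z} → a ≤ z × z ⊏ b → μfuel P k₁ a z ≡ μfuel P k₂ a z
    same (_ , z⊏b) = μfuel-stable k₁ k₂ a _ (ℕP.≤-pred (ℕP.<-≤-trans (ρ-< z⊏b) h₁))
                                            (ℕP.≤-pred (ℕP.<-≤-trans (ρ-< z⊏b) h₂))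

  μ-refl : ∀ a → μ P a a ≡ 1ℤ
  μ-refl a with a ≟F a
  ... | yes _   = refl
  ... | no a≢a = contradiction refl a≢a

  μ-unfold : ∀ {a b} → a ⊏ b → μ P a b ≡ ℤ.- Σℤ (filter (λ z → (a ≤? z) ×-dec (z ⊏? b)) E) (μ P a)
  μ-unfold {a} {b} (a≤b , a≢b) =
    trans (μfuel-stable (ρ b) (suc (ρ b)) a b ℕP.≤-refl (ℕP.n≤1+n _)) unfolded
    where
    unfolded : μfuel P (suc (ρ b)) a b ≡ ℤ.- Σℤ (filter (λ z → (a ≤? z) ×-dec (z ⊏? b)) E) (μ P a)
    unfolded with a ≟F b
    ... | yes a≡b = contradiction a≡b a≢b
    ... | no _ with a ≤? b
    ...   | no a≰b = contradiction a≤b a≰b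
    ...   | yes _  = cong ℤ.-_ (Σℤ-cong-local (All.map
            (λ {z} (_ , z⊏b) → μfuel-stable (ρ b) (ρ z) a z (ℕP.<⇒≤ (ρ-< z⊏b)) ℕP.≤-refl)
            (all-filter (λ z → (a ≤? z) ×-dec (z ⊏? b)) E)))

  ≤⇒≡⊎⊏ : ∀ {x y} → x ≤ y → x ≡ y ⊎ x ⊏ y
  ≤⇒≡⊎⊏ {x} {y} x≤y with x ≟F y
  ... | yes x≡y = inj₁ x≡y
  ... | no  x≢y = inj₂ (x≤y , x≢y)

  -- The Möbius function

  μ-sumˡ : Fin size → Fin size → ℤ
  μ-sumˡ a w = ℤΣ.Σ E (λ z → ℤΣ.ind (z ∈[ a , w ]?) (μ P a z))

  μ-sumʳ : Fin size → Fin size → ℤ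
  μ-sumʳ a b = ℤΣ.Σ E (λ w → ℤΣ.ind (w ∈[ a , b ]?) (μ P w b))

  μ-sumˡ-refl : ∀ a → μ-sumˡ a a ≡ 1ℤ
  μ-sumˡ-refl a = trans
    (ℤΣ.Σ-allFin-unique size (_∈[ a , a ]?) a (μ P a)
                        (λ _ (a≤z , z≤a) → ≤-antisym z≤a a≤z) (≤-refl a , ≤-refl a))
    (μ-refl a)

  μ-sumʳ-refl : ∀ b → μ-sumʳ b b ≡ 1ℤ
  μ-sumʳ-refl b = trans
    (ℤΣ.Σ-allFin-unique size (_∈[ b , b ]?) b (λ w → μ P w b)
                        (λ _ (b≤w , w≤b) → ≤-antisym w≤b b≤w) (≤-refl b , ≤-refl b))
    (μ-refl b)

  μ-sumˡ-< : ∀ {a w} → a ⊏ w → μ-sumˡ a w ≡ 0ℤ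
  μ-sumˡ-< {a} {w} a⊏w@(a≤w , _) = begin
    μ-sumˡ a w
      ≡⟨ ℤΣ.Σ-allFin-split size (_∈[ a , w ]?) below? w (μ P a)
           (λ z (a≤z , z≤w) → Sum.map₂ (a≤z ,_) (≤⇒≡⊎⊏ z≤w)) (λ z (a≤z , z⊏w) → a≤z , proj₁ z⊏w)
           (a≤w , ≤-refl w) (λ (_ , _ , w≢w) → w≢w refl) ⟩
    μ P a w ℤ.+ ℤΣ.Σ E (λ z → ℤΣ.ind (below? z) (μ P a z))
      ≡⟨ cong (λ t → μ P a w ℤ.+ t) (ℤΣ.Σ-filter below? E (μ P a)) ⟨
    μ P a w ℤ.+ Σℤ (filter below? E) (μ P a)
      ≡⟨ cong (ℤ._+ Σℤ (filter below? E) (μ P a)) (μ-unfold a⊏w) ⟩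
    ℤ.- Σℤ (filter below? E) (μ P a) ℤ.+ Σℤ (filter below? E) (μ P a)
      ≡⟨ ℤP.+-inverseˡ (Σℤ (filter below? E) (μ P a)) ⟩
    0ℤ
      ∎
    where
    open ≡-Reasoning
    below? : ∀ z → Dec (a ≤ z × z ⊏ w)
    below? z = (a ≤? z) ×-dec (z ⊏? w)

  -- The dual recursion, by induction on ρ b − ρ a: evaluate
  -- Σ_{a ≤ z ≤ w ≤ b} μ(a,z) μ(w,b) summing over z first and over w first.
  μ-sumʳ-<-bounded : ∀ n {a b} → a ⊏ b → ρ b ℕ.≤ n ℕ.+ ρ a → μ-sumʳ a b ≡ 0ℤ
  μ-sumʳ-<-bounded zero    a⊏b ρb≤ρa = contradiction (ℕP.<-≤-trans (ρ-< a⊏b) ρb≤ρa) (ℕP.<-irrefl refl)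
  μ-sumʳ-<-bounded (suc n) {a} {b} a⊏b@(a≤b , a≢b) bound =
    identityˡ-unique (μ-sumʳ a b) (μ P a b) (trans (sym over-z-first) over-w-first)
    where
    open ≡-Reasoning
    above? : ∀ x → Dec (a ⊏ x × x ≤ b)
    above? x = (a ⊏? x) ×-dec (x ≤? b)
    interior? : ∀ x → Dec (a ⊏ x × x ⊏ b)
    interior? x = (a ⊏? x) ×-dec (x ⊏? b)
    split-a : ∀ x → a ≤ x × x ≤ b → x ≡ a ⊎ (a ⊏ x × x ≤ b)
    split-a x (a≤x , x≤b) = Sum.map sym (_, x≤b) (≤⇒≡⊎⊏ a≤x)
    a∉above : ¬ (a ⊏ a × a ≤ b)
    a∉above ((_ , a≢a) , _) = a≢a refl

    over-w-first : ℤΣ.Σ E (λ w → ℤΣ.ind (w ∈[ a , b ]?) (μ-sumˡ a w ℤ.* μ P w b)) ≡ μ P a b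
    over-w-first = begin
      ℤΣ.Σ E (λ w → ℤΣ.ind (w ∈[ a , b ]?) (μ-sumˡ a w ℤ.* μ P w b))
        ≡⟨ ℤΣ.Σ-allFin-split size (_∈[ a , b ]?) above? a (λ w → μ-sumˡ a w ℤ.* μ P w b)
             split-a (λ _ ((a≤x , _) , x≤b) → a≤x , x≤b) (≤-refl a , a≤b) a∉above ⟩
      μ-sumˡ a a ℤ.* μ P a b ℤ.+ ℤΣ.Σ E (λ w → ℤΣ.ind (above? w) (μ-sumˡ a w ℤ.* μ P w b))
        ≡⟨ cong₂ ℤ._+_ (cong (ℤ._* μ P a b) (μ-sumˡ-refl a))
                       (ℤΣ.Σ-ind-zero above? E (λ w (a⊏w , _) → cong (ℤ._* μ P w b) (μ-sumˡ-< a⊏w))) ⟩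
      1ℤ ℤ.* μ P a b ℤ.+ 0ℤ
        ≡⟨ trans (ℤP.+-identityʳ _) (ℤP.*-identityˡ _) ⟩
      μ P a b
        ∎

    over-z-first : ℤΣ.Σ E (λ w → ℤΣ.ind (w ∈[ a , b ]?) (μ-sumˡ a w ℤ.* μ P w b))
                   ≡ μ-sumʳ a b ℤ.+ μ P a b
    over-z-first = begin
      ℤΣ.Σ E (λ w → ℤΣ.ind (w ∈[ a , b ]?) (μ-sumˡ a w ℤ.* μ P w b))
        ≡⟨ ℤΣ.Σ-ind-Σ-swap E E (_∈[ a , b ]?) (λ w z → z ∈[ a , w ]?) (_∈[ a , b ]?) (λ z w → w ∈[ z , b ]?)
             (λ _ _ ((a≤w , w≤b) , (a≤z , z≤w)) → (a≤z , ≤-trans z≤w w≤b) , (z≤w , w≤b))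
             (λ _ _ ((a≤z , z≤b) , (z≤w , w≤b)) → (≤-trans a≤z z≤w , w≤b) , (a≤z , z≤w))
             (λ w → μ P w b) (μ P a) ⟩
      ℤΣ.Σ E (λ z → ℤΣ.ind (z ∈[ a , b ]?) (μ-sumʳ z b ℤ.* μ P a z))
        ≡⟨ ℤΣ.Σ-allFin-split size (_∈[ a , b ]?) above? a (λ z → μ-sumʳ z b ℤ.* μ P a z)
             split-a (λ _ ((a≤x , _) , x≤b) → a≤x , x≤b) (≤-refl a , a≤b) a∉above ⟩
      μ-sumʳ a b ℤ.* μ P a a ℤ.+ ℤΣ.Σ E (λ z → ℤΣ.ind (above? z) (μ-sumʳ z b ℤ.* μ P a z))
        ≡⟨ cong (λ t → μ-sumʳ a b ℤ.* μ P a a ℤ.+ t)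
             (ℤΣ.Σ-allFin-split size above? interior? b (λ z → μ-sumʳ z b ℤ.* μ P a z)
               (λ z (a⊏z , z≤b) → Sum.map₂ (a⊏z ,_) (≤⇒≡⊎⊏ z≤b)) (λ _ (a⊏z , z⊏b) → a⊏z , proj₁ z⊏b)
               (a⊏b , ≤-refl b) (λ (_ , _ , b≢b) → b≢b refl)) ⟩
      μ-sumʳ a b ℤ.* μ P a a ℤ.+ (μ-sumʳ b b ℤ.* μ P a b
                                  ℤ.+ ℤΣ.Σ E (λ z → ℤΣ.ind (interior? z) (μ-sumʳ z b ℤ.* μ P a z)))
        ≡⟨ cong₂ ℤ._+_ (trans (cong (μ-sumʳ a b ℤ.*_) (μ-refl a)) (ℤP.*-identityʳ (μ-sumʳ a b)))
             (cong₂ ℤ._+_ (trans (cong (ℤ._* μ P a b) (μ-sumʳ-refl b)) (ℤP.*-identityˡ (μ P a b)))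
                          (ℤΣ.Σ-ind-zero interior? E (λ z (a⊏z , z⊏b) →
                             cong (ℤ._* μ P a z) (μ-sumʳ-<-bounded n z⊏b (shrink a⊏z))))) ⟩
      μ-sumʳ a b ℤ.+ (μ P a b ℤ.+ 0ℤ)
        ≡⟨ cong (λ t → μ-sumʳ a b ℤ.+ t) (ℤP.+-identityʳ _) ⟩
      μ-sumʳ a b ℤ.+ μ P a b
        ∎
      where
      shrink : ∀ {z} → a ⊏ z → ρ b ℕ.≤ n ℕ.+ ρ z
      shrink a⊏z =
        ℕP.≤-trans bound (ℕP.≤-trans (ℕP.≤-reflexive (sym (ℕP.+-suc n _))) (ℕP.+-monoʳ-≤ n (ρ-< a⊏z)))

  μ-sumʳ-< : ∀ {a b} → a ⊏ b → μ-sumʳ a b ≡ 0ℤ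
  μ-sumʳ-< {a} {b} a⊏b = μ-sumʳ-<-bounded (ρ b) a⊏b (ℕP.m≤m+n (ρ b) (ρ a))

  μ-sum-half-open : ∀ {a b} → a ⊏ b → ℤΣ.Σ E (λ q → ℤΣ.ind ((a ≤? q) ×-dec (q ⊏? b)) (μ P q b)) ≡ ℤ.- 1ℤ
  μ-sum-half-open {a} {b} a⊏b@(a≤b , _) = inverseʳ-unique 1ℤ _ (begin
    1ℤ ℤ.+ ℤΣ.Σ E (λ q → ℤΣ.ind (below? q) (μ P q b))
      ≡⟨ cong (ℤ._+ ℤΣ.Σ E (λ q → ℤΣ.ind (below? q) (μ P q b))) (μ-refl b) ⟨
    μ P b b ℤ.+ ℤΣ.Σ E (λ q → ℤΣ.ind (below? q) (μ P q b))
      ≡⟨ ℤΣ.Σ-allFin-split size (_∈[ a , b ]?) below? b (λ q → μ P q b)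
           (λ q (a≤q , q≤b) → Sum.map₂ (a≤q ,_) (≤⇒≡⊎⊏ q≤b)) (λ _ (a≤q , q⊏b) → a≤q , proj₁ q⊏b)
           (a≤b , ≤-refl b) (λ (_ , _ , b≢b) → b≢b refl) ⟨
    μ-sumʳ a b
      ≡⟨ μ-sumʳ-< a⊏b ⟩
    0ℤ
      ∎)
    where
    open ≡-Reasoning
    below? : ∀ q → Dec (a ≤ q × q ⊏ b)
    below? q = (a ≤? q) ×-dec (q ⊏? b)

  open ℒΣ

  μ-inversion : ∀ b (f : Fin size → Laur) →
    Σ E (λ q → ind (q ⊏? b) (Σ E (λ s → ind (s ≤? q) (f s)) *L constL (μ P q b)))
    ≈ₗ -L Σ E (λ s → ind (s ⊏? b) (f s))
  μ-inversion b f = begin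
    Σ E (λ q → ind (q ⊏? b) (Σ E (λ s → ind (s ≤? q) (f s)) *L constL (μ P q b)))
      ≈⟨ Σ-ind-Σ-swap E E (_⊏? b) (λ q s → s ≤? q) (_⊏? b) (λ s q → (s ≤? q) ×-dec (q ⊏? b))
           (λ q s (q⊏b@(q≤b , q≢b) , s≤q) →
              (≤-trans s≤q q≤b , λ { refl → q≢b (≤-antisym q≤b s≤q) }) , (s≤q , q⊏b))
           (λ q s (_ , (s≤q , q⊏b)) → q⊏b , s≤q)
           (λ q → constL (μ P q b)) f ⟩
    Σ E (λ s → ind (s ⊏? b) (Σ E (λ q → ind ((s ≤? q) ×-dec (q ⊏? b)) (constL (μ P q b))) *L f s))
      ≈⟨ Σ-cong E (λ s → ind-cong (s ⊏? b) (λ s⊏b → *L-cong (μ-sum-aboveL s⊏b) (≈ₗ-refl {f s}))) ⟩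
    Σ E (λ s → ind (s ⊏? b) (-L 1L *L f s))
      ≈⟨ Σ-cong E (λ s → ≈ₗ-trans (ind-cong (s ⊏? b) (λ _ → -1*x≈-x (f s))) (ind-neg (s ⊏? b) (f s))) ⟩
    Σ E (λ s → -L ind (s ⊏? b) (f s))
      ≈⟨ -‿Σ E _ ⟨
    -L Σ E (λ s → ind (s ⊏? b) (f s))
      ∎
    where
    open import Relation.Binary.Reasoning.Setoid ℒ.setoid
    μ-sum-aboveL : ∀ {s} → s ⊏ b → Σ E (λ q → ind ((s ≤? q) ×-dec (q ⊏? b)) (constL (μ P q b))) ≈ₗ -L 1L
    μ-sum-aboveL {s} s⊏b = begin
      Σ E (λ q → ind ((s ≤? q) ×-dec (q ⊏? b)) (constL (μ P q b)))
        ≈⟨ Σ-cong E (λ q → constL-ind ((s ≤? q) ×-dec (q ⊏? b)) (μ P q b)) ⟨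
      Σ E (λ q → constL (ℤΣ.ind ((s ≤? q) ×-dec (q ⊏? b)) (μ P q b)))
        ≈⟨ constL-Σ E _ ⟨
      constL (ℤΣ.Σ E (λ q → ℤΣ.ind ((s ≤? q) ×-dec (q ⊏? b)) (μ P q b)))
        ≈⟨ ≡⇒≈ₗ (cong constL (μ-sum-half-open s⊏b)) ⟩
      constL (ℤ.- 1ℤ)
        ≈⟨ constL-neg 1ℤ ⟩
      -L 1L
        ∎

  -- Toric h-polynomials as sums over lower intervals

  hTerm : ℕ → Fin size → Laur
  hTerm r s = poly (gHat P s) *L yL ^L (r ∸ ρ s)

  hTermRev : ℕ → Fin size → Laur
  hTermRev r s = (-L yL) ^L (r ∸ ρ s) *L evalAt (gHat P s) xinvL *L xL ^L ρ s

  hTermsBelow : ℕ → Fin size → Laur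
  hTermsBelow d q = Σ E (λ s → ind (s ≤? q) (hTerm d s))

  hHat-unfold : ∀ {t r} → ρ t ≡ suc r → hHat P t ≡ hSum P r t r
  hHat-unfold ρt≡1+r rewrite ρt≡1+r = refl

  hHat≈Σ : ∀ {t r} → ρ t ≡ suc r → poly (hHat P t) ≈ₗ Σ E (λ s → ind (s ⊏? t) (hTerm r s))
  hHat≈Σ {t} {r} ρt≡1+r = begin
    poly (hHat P t)
      ≡⟨ cong poly (hHat-unfold ρt≡1+r) ⟩
    poly (hSum P r t r)
      ≈⟨ poly-Σ (filter (_⊏? t) E) summand ⟩
    Σ (filter (_⊏? t) E) (poly ∘ summand)
      ≈⟨ Σ-filter (_⊏? t) E (poly ∘ summand) ⟩
    Σ E (λ s → ind (s ⊏? t) (poly (summand s)))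
      ≈⟨ Σ-cong E (λ s → ind-cong (s ⊏? t) (λ s⊏t →
           *L-cong (≡⇒≈ₗ (cong poly (gFuel≡gHat r s (ρ-<-pred s⊏t ρt≡1+r)))) (poly-powP-yₚ P (r ∸ ρ s)))) ⟩
    Σ E (λ s → ind (s ⊏? t) (hTerm r s))
      ∎
    where
    open import Relation.Binary.Reasoning.Setoid ℒ.setoid
    summand : Fin size → Poly
    summand s = gFuel P r s *p powP P yₚ (r ∸ ρ s)

  x^r*hHat[x⁻¹]≈Σ : ∀ {t r} → ρ t ≡ suc r →
                    xL ^L r *L evalAt (hHat P t) xinvL ≈ₗ Σ E (λ s → ind (s ⊏? t) (hTermRev r s))
  x^r*hHat[x⁻¹]≈Σ {t} {r} ρt≡1+r = begin
    xL ^L r *L evalAt (hHat P t) xinvL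
      ≡⟨ cong (λ h → xL ^L r *L evalAt h xinvL) (hHat-unfold ρt≡1+r) ⟩
    xL ^L r *L evalAt (hSum P r t r) xinvL
      ≈⟨ *L-cong (≈ₗ-refl {xL ^L r}) (≈ₗ-trans (evalAt-Σ (filter (_⊏? t) E) summand xinvL)
                                               (Σ-filter (_⊏? t) E _)) ⟩
    xL ^L r *L Σ E (λ s → ind (s ⊏? t) (evalAt (summand s) xinvL))
      ≈⟨ Σ-*ˡ E (xL ^L r) _ ⟩
    Σ E (λ s → xL ^L r *L ind (s ⊏? t) (evalAt (summand s) xinvL))
      ≈⟨ Σ-cong E (λ s → ≈ₗ-trans (ind-*ˡ (s ⊏? t) (xL ^L r) _) (ind-cong (s ⊏? t) (λ s⊏t →
           ≈ₗ-trans (x^r*evalAt-x⁻¹ P (gFuel P r s) (ρ-<-pred s⊏t ρt≡1+r))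
                    (≡⇒≈ₗ (cong (λ g → (-L yL) ^L (r ∸ ρ s) *L evalAt g xinvL *L xL ^L ρ s)
                                (gFuel≡gHat r s (ρ-<-pred s⊏t ρt≡1+r))))))) ⟩
    Σ E (λ s → ind (s ⊏? t) (hTermRev r s))
      ∎
    where
    open import Relation.Binary.Reasoning.Setoid ℒ.setoid
    summand : Fin size → Poly
    summand s = gFuel P r s *p powP P yₚ (r ∸ ρ s)

  y^*[gHat+y*hHat]≈Σ : ∀ {q d} → 1 ℕ.≤ ρ q → ρ q ℕ.≤ d →
    yL ^L (d ∸ ρ q) *L (poly (gHat P q) +L yL *L poly (hHat P q)) ≈ₗ hTermsBelow d q
  y^*[gHat+y*hHat]≈Σ {q} {d} 1≤ρq ρq≤d = begin
    yL ^L n *L (poly (gHat P q) +L yL *L poly (hHat P q))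
      ≈⟨ *L-distribˡ (yL ^L n) (poly (gHat P q)) _ ⟩
    yL ^L n *L poly (gHat P q) +L yL ^L n *L (yL *L poly (hHat P q))
      ≈⟨ +L-cong (*L-comm (yL ^L n) _) (*L-cong (≈ₗ-refl {yL ^L n}) (*L-cong (≈ₗ-refl {yL}) (hHat≈Σ ρq≡1+r))) ⟩
    hTerm d q +L yL ^L n *L (yL *L Σ E (λ s → ind (s ⊏? q) (hTerm r s)))
      ≈⟨ +L-cong (≈ₗ-refl {hTerm d q}) (≈ₗ-trans
           (*L-cong (≈ₗ-refl {yL ^L n}) (≈ₗ-trans (Σ-*ˡ E yL _) (Σ-cong E (λ s → ind-*ˡ (s ⊏? q) yL _))))
           (≈ₗ-trans (Σ-*ˡ E (yL ^L n) _) (Σ-cong E (λ s → ≈ₗ-trans (ind-*ˡ (s ⊏? q) (yL ^L n) _)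
                                                                  (ind-cong (s ⊏? q) (raise s)))))) ⟩
    hTerm d q +L Σ E (λ s → ind (s ⊏? q) (hTerm d s))
      ≈⟨ Σ-allFin-split size (_≤? q) (_⊏? q) q (hTerm d) (λ s → ≤⇒≡⊎⊏) (λ _ → proj₁)
           (≤-refl q) (λ (_ , q≢q) → q≢q refl) ⟨
    hTermsBelow d q
      ∎
    where
    open import Relation.Binary.Reasoning.Setoid ℒ.setoid
    n r : ℕ
    n = d ∸ ρ q
    r = ℕ.pred (ρ q)
    ρq≡1+r : ρ q ≡ suc r
    ρq≡1+r = sym (ℕP.suc-pred (ρ q) ⦃ ℕ.>-nonZero 1≤ρq ⦄)
    regroup : ∀ a b g c → a *L (b *L (g *L c)) ≈ₗ g *L ((b *L a) *L c)
    regroup = Solver.solve-∀ Laurent-ring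
    exponent : ∀ {s} → s ⊏ q → suc n ℕ.+ (r ∸ ρ s) ≡ d ∸ ρ s
    exponent {s} s⊏q =
      trans (sym (ℕP.+-suc n _))
      (trans (cong (n ℕ.+_) (sym (ℕP.+-∸-assoc 1 ρs≤r)))
      (trans (cong (λ k → n ℕ.+ (k ∸ ρ s)) (sym ρq≡1+r))
             ([m∸n]+[n∸o]≡m∸o (ℕP.<⇒≤ (ρ-< s⊏q)) ρq≤d)))
      where ρs≤r = ρ-<-pred s⊏q ρq≡1+r
    raise : ∀ s → s ⊏ q → yL ^L n *L (yL *L hTerm r s) ≈ₗ hTerm d s
    raise s s⊏q = ≈ₗ-trans (regroup (yL ^L n) yL (poly (gHat P s)) (yL ^L (r ∸ ρ s)))
      (*L-cong (≈ₗ-refl {poly (gHat P s)})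
               (≈ₗ-trans (≈ₗ-sym (^L-+ yL (suc n) (r ∸ ρ s))) (≡⇒≈ₗ (cong (yL ^L_) (exponent s⊏q)))))

  gHat-𝟘 : gHat P 𝟘 ≡ 1ℤ ∷ []
  gHat-𝟘 = sym (gFuel≡gHat 0 𝟘 (ℕP.≤-reflexive ρ-𝟘))

  Σ-≤𝟘 : (f : Fin size → Laur) → Σ E (λ s → ind (s ≤? 𝟘) (f s)) ≈ₗ f 𝟘
  Σ-≤𝟘 f = Σ-allFin-unique size (_≤? 𝟘) 𝟘 f (λ s s≤𝟘 → ≤-antisym s≤𝟘 (𝟘-min s)) (≤-refl 𝟘)

  hTerm-𝟘 : ∀ d → hTerm d 𝟘 ≈ₗ yL ^L d
  hTerm-𝟘 d = ≈ₗ-trans (≡⇒≈ₗ (cong₂ (λ g k → poly g *L yL ^L (d ∸ k)) gHat-𝟘 ρ-𝟘)) (*L-identityˡ _)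

  hTermRev-𝟘 : ∀ d → hTermRev d 𝟘 ≈ₗ -L ((-L 1L) ^L suc d *L yL ^L d)
  hTermRev-𝟘 d =
    ≈ₗ-trans (≡⇒≈ₗ (cong₂ (λ g k → (-L yL) ^L (d ∸ k) *L evalAt g xinvL *L xL ^L k) gHat-𝟘 ρ-𝟘))
    (≈ₗ-trans (*L-identityʳ _)
    (≈ₗ-trans (*L-cong (≈ₗ-refl {(-L yL) ^L d}) (evalAt-1 xinvL))
    (≈ₗ-trans (*L-identityʳ _) (-‿^L yL d))))

  module _ {d : ℕ} (ρ𝟙≡1+d : ρ 𝟙 ≡ suc d) where

    midRank? : ∀ q → Dec (1 ℕ.≤ ρ q × ρ q ℕ.≤ d)
    midRank? q = (1 ℕ.≤? ρ q) ×-dec (ρ q ℕ.≤? d)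

    Σ-midRank : (Fin size → Laur) → Laur
    Σ-midRank f = Σ E (λ q → ind (midRank? q) (f q))

    Σ-⊏𝟙-split : (f : Fin size → Laur) → Σ E (λ s → ind (s ⊏? 𝟙) (f s)) ≈ₗ f 𝟘 +L Σ-midRank f
    Σ-⊏𝟙-split f = Σ-allFin-split size (_⊏? 𝟙) midRank? 𝟘 f
      (λ s s⊏𝟙 → Sum.map sym (λ 𝟘⊏s → subst (ℕ._< ρ s) ρ-𝟘 (ρ-< 𝟘⊏s) , ρ-<-pred s⊏𝟙 ρ𝟙≡1+d)
                             (≤⇒≡⊎⊏ (𝟘-min s)))
      (λ s (_ , ρs≤d) → 𝟙-max s , λ { refl → ℕP.1+n≰n (subst (ℕ._≤ d) ρ𝟙≡1+d ρs≤d) })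
      (𝟙-max 𝟘 , λ 𝟘≡𝟙 → ℕP.0≢1+n (trans (sym ρ-𝟘) (trans (cong ρ 𝟘≡𝟙) ρ𝟙≡1+d)))
      (λ (1≤ρ𝟘 , _) → ℕP.1+n≰n (subst (1 ℕ.≤_) ρ-𝟘 1≤ρ𝟘))

    hHat-𝟙≈ : poly (hHat P 𝟙) ≈ₗ yL ^L d +L Σ-midRank (hTerm d)
    hHat-𝟙≈ = ≈ₗ-trans (hHat≈Σ ρ𝟙≡1+d) (≈ₗ-trans (Σ-⊏𝟙-split (hTerm d)) (+L-cong (hTerm-𝟘 d) ≈ₗ-refl))

    x^d*hHat-𝟙[x⁻¹]≈ : xL ^L d *L evalAt (hHat P 𝟙) xinvL
                       ≈ₗ -L ((-L 1L) ^L suc d *L yL ^L d) +L Σ-midRank (hTermRev d)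
    x^d*hHat-𝟙[x⁻¹]≈ =
      ≈ₗ-trans (x^r*hHat[x⁻¹]≈Σ ρ𝟙≡1+d) (≈ₗ-trans (Σ-⊏𝟙-split (hTermRev d)) (+L-cong (hTermRev-𝟘 d) ≈ₗ-refl))

    μ-inversion-midRank :
      yL ^L d *L constL (μ P 𝟘 𝟙) +L Σ-midRank (λ q → hTermsBelow d q *L constL (μ P q 𝟙))
      ≈ₗ -L (yL ^L d +L Σ-midRank (hTerm d))
    μ-inversion-midRank = begin
      yL ^L d *L constL (μ P 𝟘 𝟙) +L Σ-midRank (λ q → hTermsBelow d q *L constL (μ P q 𝟙))
        ≈⟨ +L-cong (*L-cong (≈ₗ-trans (Σ-≤𝟘 (hTerm d)) (hTerm-𝟘 d)) (≈ₗ-refl {constL (μ P 𝟘 𝟙)})) ≈ₗ-refl ⟨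
      hTermsBelow d 𝟘 *L constL (μ P 𝟘 𝟙) +L Σ-midRank (λ q → hTermsBelow d q *L constL (μ P q 𝟙))
        ≈⟨ Σ-⊏𝟙-split (λ q → hTermsBelow d q *L constL (μ P q 𝟙)) ⟨
      Σ E (λ q → ind (q ⊏? 𝟙) (hTermsBelow d q *L constL (μ P q 𝟙)))
        ≈⟨ μ-inversion 𝟙 (hTerm d) ⟩
      -L Σ E (λ s → ind (s ⊏? 𝟙) (hTerm d s))
        ≈⟨ -L-cong (≈ₗ-trans (Σ-⊏𝟙-split (hTerm d)) (+L-cong (hTerm-𝟘 d) ≈ₗ-refl)) ⟩
      -L (yL ^L d +L Σ-midRank (hTerm d))
        ∎
      where open import Relation.Binary.Reasoning.Setoid ℒ.setoid

    Σ-midRank-summands :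
      ΣL (filter midRank? E) (λ q →
          -L (yL ^L (d ∸ ρ q) *L (poly (gHat P q) +L yL *L poly (hHat P q)) *L constL (μ P q 𝟙))
          -L hTermRev d q)
      ≈ₗ -L Σ-midRank (λ q → hTermsBelow d q *L constL (μ P q 𝟙)) -L Σ-midRank (hTermRev d)
    Σ-midRank-summands = begin
      ΣL (filter midRank? E) summand
        ≈⟨ Σ-filter midRank? E summand ⟩
      Σ-midRank summand
        ≈⟨ Σ-cong E (λ q → ≈ₗ-trans
             (ind-cong (midRank? q) (λ (1≤ρq , ρq≤d) →
                +L-cong (-L-cong (*L-cong (y^*[gHat+y*hHat]≈Σ 1≤ρq ρq≤d) ≈ₗ-refl)) ≈ₗ-refl))
             (≈ₗ-trans (ind-+ (midRank? q) _ _) (+L-cong (ind-neg (midRank? q) _) (ind-neg (midRank? q) _)))) ⟩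
      Σ E (λ q → -L ind (midRank? q) (hTermsBelow d q *L constL (μ P q 𝟙)) -L ind (midRank? q) (hTermRev d q))
        ≈⟨ Σ-+ E _ _ ⟩
      Σ E (λ q → -L ind (midRank? q) (hTermsBelow d q *L constL (μ P q 𝟙)))
        +L Σ E (λ q → -L ind (midRank? q) (hTermRev d q))
        ≈⟨ +L-cong (-‿Σ E _) (-‿Σ E _) ⟨
      -L Σ-midRank (λ q → hTermsBelow d q *L constL (μ P q 𝟙)) -L Σ-midRank (hTermRev d)
        ∎
      where
      open import Relation.Binary.Reasoning.Setoid ℒ.setoid
      summand : Fin size → Laur
      summand q = -L (yL ^L (d ∸ ρ q) *L (poly (gHat P q) +L yL *L poly (hHat P q)) *L constL (μ P q 𝟙))
                  -L hTermRev d q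

open import Data.Nat using (_≤?_)
open GradedPoset using (ρ; 𝟘; 𝟙)

lemma5p7 : (P : GradedPoset) (d : ℕ) → ρ P (𝟙 P) ≡ suc d →
    poly (hHat P (𝟙 P)) -L xL ^L d *L evalAt (hHat P (𝟙 P)) xinvL
    ≈L
    -L ((constL (μ P (𝟘 P) (𝟙 P)) -L (-L 1L) ^L suc d) *L y P ^L d)
    +L ΣL (filter (λ q → (1 ≤? ρ P q) ×-dec (ρ P q ≤? d)) (elems P))
          (λ q → -L (y P ^L (d ∸ ρ P q) *L (poly (gHat P q) +L y P *L poly (hHat P q)) *L constL (μ P q (𝟙 P)))
                 -L (-L y P) ^L (d ∸ ρ P q) *L evalAt (gHat P q) xinvL *L xL ^L ρ P q)
lemma5p7 P d ρ𝟙≡1+d = coeffL-≈ₗ (begin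
  poly (hHat P (𝟙 P)) -L xL ^L d *L evalAt (hHat P (𝟙 P)) xinvL
    ≈⟨ +L-cong (hHat-𝟙≈ P ρ𝟙≡1+d) (-L-cong (x^d*hHat-𝟙[x⁻¹]≈ P ρ𝟙≡1+d)) ⟩
  (yL ^L d +L H) -L (-L (u *L yL ^L d) +L R)
    ≈⟨ regroup (yL ^L d) H R u m₀ ⟩
  -L ((m₀ -L u) *L yL ^L d) +L (-L ((-L (yL ^L d +L H)) -L yL ^L d *L m₀) -L R)
    ≈⟨ +L-cong ≈ₗ-refl (+L-cong (-L-cong (≈ₗ-sym (x+y≈z⇒y≈z-x (μ-inversion-midRank P ρ𝟙≡1+d)))) ≈ₗ-refl) ⟩
  -L ((m₀ -L u) *L yL ^L d) +L (-L F -L R)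
    ≈⟨ +L-cong ≈ₗ-refl (Σ-midRank-summands P ρ𝟙≡1+d) ⟨
  -L ((m₀ -L u) *L y P ^L d)
    +L ΣL (filter (midRank? P ρ𝟙≡1+d) (elems P))
          (λ q → -L (y P ^L (d ∸ ρ P q) *L (poly (gHat P q) +L y P *L poly (hHat P q)) *L constL (μ P q (𝟙 P)))
                 -L hTermRev P d q)
    ∎)
  where
  open import Relation.Binary.Reasoning.Setoid ℒ.setoid
  u m₀ H R F : Laur
  u  = (-L 1L) ^L suc d
  m₀ = constL (μ P (𝟘 P) (𝟙 P))
  H  = Σ-midRank P ρ𝟙≡1+d (hTerm P d)
  R  = Σ-midRank P ρ𝟙≡1+d (hTermRev P d)
  F  = Σ-midRank P ρ𝟙≡1+d (λ q → hTermsBelow P d q *L constL (μ P q (𝟙 P)))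
  regroup : ∀ yd H R u m₀ → (yd +L H) -L (-L (u *L yd) +L R)
                            ≈ₗ -L ((m₀ -L u) *L yd) +L (-L ((-L (yd +L H)) -L yd *L m₀) -L R)
  regroup = Solver.solve-∀ Laurent-ring
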